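{- Let $k \ge 0$ and $0 \le m \le k$ be integers. The coefficient of $b^{k+1+4m}$ in $p_{5k+4}(b)$ is not divisible by $5$ if and only if $m_i \le k_i$ for every $i$, where $m = \sum_i m_i 5^i$ and $k = \sum_i k_i 5^i$ are the base-$5$ expansions ($0 \le m_i, k_i \le 4$).
   Context: For a complex indeterminate $b$, define polynomials $p_n(b)$ by the formal power series identity $\prod_{j=1}^{\infty} (1-q^j)^{b-1} = \sum_{n=0}^{\infty} \frac{q^n}{n!}\, p_n(b)$. Each $p_n(b)$ is a polynomial in $b$ with integer coefficients. -}

module Defs where

open import Data.Nat as ℕ using (ℕ; zero; suc; _!; _^_)
open import Data.Nat.Properties using (_!≢0; m^n≢0)
open import Data.Nat.Divisibility using (_∣?_)
open import Data.Integer as ℤ using (ℤ; +_; -[1+_])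
open import Data.Rational as ℚ using (ℚ; 0ℚ; 1ℚ; _/_; _+_; _*_; -_)
open import Data.List using (List; []; _∷_)
open import Data.Product using (∃)
open import Relation.Binary.PropositionalEquality using (_≡_)
open import Relation.Nullary using (yes; no)

-- Polynomials in the indeterminate b with rational coefficients,
-- represented as coefficient lists (constant term first).

Poly : Set
Poly = List ℚ

_+ᴾ_ : Poly → Poly → Poly
[]       +ᴾ q        = q
(a ∷ p)  +ᴾ []       = a ∷ p
(a ∷ p)  +ᴾ (c ∷ q)  = (a + c) ∷ (p +ᴾ q)

scaleᴾ : ℚ → Poly → Poly
scaleᴾ c []      = []
scaleᴾ c (a ∷ p) = (c * a) ∷ scaleᴾ c p

_*ᴾ_ : Poly → Poly → Poly
[]      *ᴾ q = []
(a ∷ p) *ᴾ q = scaleᴾ a q +ᴾ (0ℚ ∷ (p *ᴾ q))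

constᴾ : ℚ → Poly
constᴾ c = c ∷ []

coeff : Poly → ℕ → ℚ
coeff []      i       = 0ℚ
coeff (a ∷ p) zero    = a
coeff (a ∷ p) (suc i) = coeff p i

-- Generalised binomial coefficient  C(b-1, r) = (b-1)(b-2)...(b-r) / r!
-- as a polynomial in b.

fallingᴾ : ℕ → Poly
fallingᴾ zero    = constᴾ 1ℚ
fallingᴾ (suc r) = fallingᴾ r *ᴾ ((- (+ (suc r) / 1)) ∷ 1ℚ ∷ [])

binomᴾ : ℕ → Poly
binomᴾ r = scaleᴾ ((+ 1 / (r !)) {{r !≢0}}) (fallingᴾ r)

sign : ℕ → ℚ
sign zero    = 1ℚ
sign (suc r) = - sign r

-- Formal power series in q with coefficients in ℚ[b]:
-- a series is the function n ↦ (coefficient of q^n).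

Series : Set
Series = ℕ → Poly

sumTo : (ℕ → Poly) → ℕ → Poly
sumTo f zero    = f zero
sumTo f (suc n) = sumTo f n +ᴾ f (suc n)

_*ˢ_ : Series → Series → Series
(f *ˢ g) n = sumTo (λ i → f i *ᴾ g (n ℕ.∸ i)) n

oneˢ : Series
oneˢ zero    = constᴾ 1ℚ
oneˢ (suc n) = []

-- The factor (1 - q^j)^(b-1) = Σ_r (-1)^r C(b-1,r) q^(j r), for j = suc j'
-- (binomial series; exponent b-1 is an indeterminate).
factorˢ : ℕ → Series
factorˢ j' n with suc j' ∣? n
... | yes _ = scaleᴾ (sign (n ℕ./ suc j')) (binomᴾ (n ℕ./ suc j'))
... | no  _ = []

prodTo : ℕ → Series
prodTo zero    = oneˢ
prodTo (suc N) = prodTo N *ˢ factorˢ N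

-- Coefficient of q^n in the infinite product ∏_{j≥1} (1-q^j)^(b-1):
-- factors with j > n are 1 + O(q^(n+1)), so the finite product up to n suffices.
prodCoeff : ℕ → Poly
prodCoeff n = prodTo n n

p : ℕ → Poly
p n = scaleᴾ (+ (n !) / 1) (prodCoeff n)

DivisibleBy5 : ℚ → Set
DivisibleBy5 c = ∃ λ (z : ℤ) → c ≡ (ℤ._*_ (+ 5) z) / 1

digit5 : ℕ → ℕ → ℕ
digit5 i n = ((n ℕ./ (5 ^ i)) {{m^n≢0 5 i}}) ℕ.% 5

module Submission where

-- (1) Logarithmic differentiation of F = ∏_j (1-q^j)^(b-1) with the Euler
--     operator θ = q d/dq gives θF = (1-b) (Σ_j j q^j/(1-q^j)) F, hence the
--     recurrence p_n = (1-b) Σ_{i≤n} σ(i) (n-1)⋯(n-i+1) p_(n-i).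
-- (2) Modulo 5 only the summands with i ≤ 5 survive and their weights are
--     5-periodic in n, so the explicit polynomials W_n with
--     W_(n+5) = (b - b⁵) W_n satisfy the same recurrence: p_n ≡ W_n (mod 5).
-- (3) In W_(5k+4) = (b - b⁵)^k W_4 the coefficient of b^(k+1+4m) is
--     2 (-1)^m C(k,m) (mod 5), and Lucas' theorem expresses 5 ∤ C(k,m)
--     through base-5 digits.

import Algebra
import Data.Nat

module PowerSeries {c ℓ} (R : Algebra.CommutativeRing c ℓ) where
  open import Algebra

  open import Data.Nat as ℕ using (ℕ; zero; suc; _<_; _≤_; z≤n; s≤s; _∸_; _/_)
  import Data.Nat.Properties as ℕP
  open import Data.Nat.Divisibility as ℕD using (_∣_; _∣?_)
  import Data.Nat.DivMod as ℕM
  open import Relation.Nullary using (yes; no; ¬_; Dec)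
  open import Data.Empty using (⊥-elim)
  open import Data.Sum using (inj₁; inj₂)
  import Relation.Binary.PropositionalEquality as P
  open P using (_≡_)
  open import Data.Product using (_,_)
  open CommutativeRing R
  open import Relation.Binary.Reasoning.Setoid setoid
  import Algebra.Construct.Pointwise ℕ as Pointwise

  open import Algebra.Solver.Ring.NaturalCoefficients.Default commutativeSemiring
    using (solve; _:+_; _:*_; _:=_; con)

  Ser : Set c
  Ser = ℕ → Carrier

  infix 4 _≋_
  _≋_ : Ser → Ser → Set ℓ
  f ≋ g = ∀ n → f n ≈ g n

  tail : Ser → Ser
  tail f n = f (suc n)

  infixl 6 _+ₛ_
  infixl 7 _*ₛ_
  infixr 7 _∙_

  _+ₛ_ : Ser → Ser → Ser
  (f +ₛ g) n = f n + g n

  -ₛ_ : Ser → Ser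
  (-ₛ f) n = - f n

  0ₛ : Ser
  0ₛ _ = 0#

  1ₛ : Ser
  1ₛ zero = 1#
  1ₛ (suc _) = 0#

  const : Carrier → Ser
  const a zero = a
  const a (suc _) = 0#

  _∙_ : Carrier → Ser → Ser
  (a ∙ f) n = a * f n

  -- Cauchy product, defined by recursion on the first factor:
  -- (f *ₛ g) = f 0 · g + q · (tail f *ₛ g).
  _*ₛ_ : Ser → Ser → Ser
  (f *ₛ g) zero = f 0 * g 0
  (f *ₛ g) (suc n) = f 0 * g (suc n) + (tail f *ₛ g) n

  ≋-refl : ∀ {f} → f ≋ f
  ≋-refl _ = refl

  ≋-sym : ∀ {f g} → f ≋ g → g ≋ f
  ≋-sym p n = sym (p n)

  ≋-trans : ∀ {f g h} → f ≋ g → g ≋ h → f ≋ h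
  ≋-trans p q n = trans (p n) (q n)

  +ₛ-cong : ∀ {f f' g g'} → f ≋ f' → g ≋ g' → f +ₛ g ≋ f' +ₛ g'
  +ₛ-cong p q n = +-cong (p n) (q n)

  ∙-cong : ∀ {a a' f f'} → a ≈ a' → f ≋ f' → a ∙ f ≋ a' ∙ f'
  ∙-cong p q n = *-cong p (q n)

  *ₛ-cong : ∀ {f f' g g'} → f ≋ f' → g ≋ g' → f *ₛ g ≋ f' *ₛ g'
  *ₛ-cong p q zero = *-cong (p 0) (q 0)
  *ₛ-cong p q (suc n) = +-cong (*-cong (p 0) (q (suc n))) (*ₛ-cong (λ m → p (suc m)) q n)

  ∙-+ₛ : ∀ a f g → a ∙ (f +ₛ g) ≋ a ∙ f +ₛ a ∙ g
  ∙-+ₛ a f g n = distribˡ a (f n) (g n)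

  0ₛ*ₛ : ∀ g → 0ₛ *ₛ g ≋ 0ₛ
  0ₛ*ₛ g zero = zeroˡ (g 0)
  0ₛ*ₛ g (suc n) = trans (+-cong (zeroˡ _) (0ₛ*ₛ g n)) (+-identityʳ 0#)

  *ₛ-distribʳ : ∀ f g h → (f +ₛ g) *ₛ h ≋ f *ₛ h +ₛ g *ₛ h
  *ₛ-distribʳ f g h zero = distribʳ (h 0) (f 0) (g 0)
  *ₛ-distribʳ f g h (suc n) =
    trans (+-congˡ (*ₛ-distribʳ (tail f) (tail g) h n)) (regroup (f 0) (g 0) (h (suc n)) _ _)
    where
    regroup : ∀ a b x u v → (a + b) * x + (u + v) ≈ (a * x + u) + (b * x + v)
    regroup = solve 5 (λ a b x u v → ((a :+ b) :* x :+ (u :+ v)) := ((a :* x :+ u) :+ (b :* x :+ v))) refl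

  ∙-*ₛ : ∀ a f g → (a ∙ f) *ₛ g ≋ a ∙ (f *ₛ g)
  ∙-*ₛ a f g zero = *-assoc a (f 0) (g 0)
  ∙-*ₛ a f g (suc n) = trans (+-congˡ (∙-*ₛ a (tail f) g n)) (factor (f 0) (g (suc n)) _)
    where
    factor : ∀ x y t → (a * x) * y + a * t ≈ a * (x * y + t)
    factor = solve 4 (λ a x y t → ((a :* x) :* y :+ a :* t) := (a :* (x :* y :+ t))) refl a

  *ₛ-unrollʳ : ∀ f g n → (f *ₛ g) (suc n) ≈ (f *ₛ tail g) n + f (suc n) * g 0
  *ₛ-unrollʳ f g zero = refl
  *ₛ-unrollʳ f g (suc n) = trans (+-congˡ (*ₛ-unrollʳ (tail f) g n)) (sym (+-assoc _ _ _))

  *ₛ-comm : ∀ f g → f *ₛ g ≋ g *ₛ f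
  *ₛ-comm f g zero = *-comm (f 0) (g 0)
  *ₛ-comm f g (suc n) =
    trans (+-congˡ (*ₛ-comm (tail f) g n)) (trans (swap (f 0) (g (suc n)) _) (sym (*ₛ-unrollʳ g f n)))
    where
    swap : ∀ x y s → x * y + s ≈ s + y * x
    swap = solve 3 (λ x y s → (x :* y :+ s) := (s :+ y :* x)) refl

  *ₛ-assoc : ∀ f g h → (f *ₛ g) *ₛ h ≋ f *ₛ (g *ₛ h)
  *ₛ-assoc f g h zero = *-assoc (f 0) (g 0) (h 0)
  *ₛ-assoc f g h (suc n) = begin
    (f 0 * g 0) * h (suc n) + (tail (f *ₛ g) *ₛ h) n
      ≈⟨ +-congˡ (*ₛ-distribʳ (f 0 ∙ tail g) (tail f *ₛ g) h n) ⟩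
    (f 0 * g 0) * h (suc n) + (((f 0 ∙ tail g) *ₛ h) n + ((tail f *ₛ g) *ₛ h) n)
      ≈⟨ +-congˡ (+-cong (∙-*ₛ (f 0) (tail g) h n) (*ₛ-assoc (tail f) g h n)) ⟩
    (f 0 * g 0) * h (suc n) + (f 0 * (tail g *ₛ h) n + (tail f *ₛ (g *ₛ h)) n)
      ≈⟨ regroup (f 0) (g 0) (h (suc n)) _ _ ⟩
    f 0 * (g 0 * h (suc n) + (tail g *ₛ h) n) + (tail f *ₛ (g *ₛ h)) n ∎
    where
    regroup : ∀ x y z u w → (x * y) * z + (x * u + w) ≈ x * (y * z + u) + w
    regroup = solve 5 (λ x y z u w → ((x :* y) :* z :+ (x :* u :+ w)) := (x :* (y :* z :+ u) :+ w)) refl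

  1ₛ*ₛ : ∀ f → 1ₛ *ₛ f ≋ f
  1ₛ*ₛ f zero = *-identityˡ (f 0)
  1ₛ*ₛ f (suc n) = trans (+-cong (*-identityˡ _) (0ₛ*ₛ f n)) (+-identityʳ _)

  *ₛ-distribˡ : ∀ f g h → f *ₛ (g +ₛ h) ≋ f *ₛ g +ₛ f *ₛ h
  *ₛ-distribˡ f g h n = trans (*ₛ-comm f (g +ₛ h) n)
    (trans (*ₛ-distribʳ g h f n) (+-cong (*ₛ-comm g f n) (*ₛ-comm h f n)))

  *ₛ-∙ : ∀ a f g → f *ₛ (a ∙ g) ≋ a ∙ (f *ₛ g)
  *ₛ-∙ a f g n = trans (*ₛ-comm f (a ∙ g) n) (trans (∙-*ₛ a g f n) (*-congˡ (*ₛ-comm g f n)))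

  const*ₛ : ∀ a f → const a *ₛ f ≋ a ∙ f
  const*ₛ a f zero = refl
  const*ₛ a f (suc n) = trans (+-congˡ (0ₛ*ₛ f n)) (+-identityʳ _)

  ∙-const : ∀ a b → a ∙ const b ≋ const (a * b)
  ∙-const a b zero = refl
  ∙-const a b (suc n) = zeroʳ a

  -- Power series over R again form a commutative ring; this lets us build
  -- series whose coefficients are themselves series (i.e. polynomials).
  seriesIsCommutativeRing : IsCommutativeRing _≋_ _+ₛ_ _*ₛ_ -ₛ_ 0ₛ 1ₛ
  seriesIsCommutativeRing = record
    { isRing = record
      { +-isAbelianGroup = Pointwise.isAbelianGroup +-isAbelianGroup
      ; *-cong = *ₛ-cong
      ; *-assoc = *ₛ-assoc
      ; *-identity = 1ₛ*ₛ , (λ f n → trans (*ₛ-comm f 1ₛ n) (1ₛ*ₛ f n))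
      ; distrib = *ₛ-distribˡ , (λ h f g → *ₛ-distribʳ f g h)
      }
    ; *-comm = *ₛ-comm
    }

  seriesRing : CommutativeRing c ℓ
  seriesRing = record { isCommutativeRing = seriesIsCommutativeRing }

  fromℕ : ℕ → Carrier
  fromℕ zero = 0#
  fromℕ (suc n) = 1# + fromℕ n

  fromℕ-+ : ∀ m n → fromℕ (m ℕ.+ n) ≈ fromℕ m + fromℕ n
  fromℕ-+ zero n = sym (+-identityˡ _)
  fromℕ-+ (suc m) n = trans (+-congˡ (fromℕ-+ m n)) (sym (+-assoc _ _ _))

  fromℕ-* : ∀ m n → fromℕ (m ℕ.* n) ≈ fromℕ m * fromℕ n
  fromℕ-* zero n = sym (zeroˡ _)
  fromℕ-* (suc m) n = begin
    fromℕ (n ℕ.+ m ℕ.* n) ≈⟨ fromℕ-+ n (m ℕ.* n) ⟩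
    fromℕ n + fromℕ (m ℕ.* n) ≈⟨ +-cong (sym (*-identityˡ _)) (fromℕ-* m n) ⟩
    1# * fromℕ n + fromℕ m * fromℕ n ≈⟨ sym (distribʳ _ _ _) ⟩
    (1# + fromℕ m) * fromℕ n ∎

  -- The Euler operator θ = q d/dq, multiplying the n-th coefficient by n.
  θ : Ser → Ser
  θ f n = fromℕ n * f n

  θ-cong : ∀ {f g} → f ≋ g → θ f ≋ θ g
  θ-cong p n = *-congˡ (p n)

  tail-θ : ∀ f → tail (θ f) ≋ θ (tail f) +ₛ tail f
  tail-θ f n = trans (distribʳ _ _ _) (trans (+-comm _ _) (+-congˡ (*-identityˡ _)))

  θ-1ₛ : θ 1ₛ ≋ 0ₛ
  θ-1ₛ zero = zeroˡ _
  θ-1ₛ (suc n) = zeroʳ _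

  θ-leibniz : ∀ f g → θ (f *ₛ g) ≋ θ f *ₛ g +ₛ f *ₛ θ g
  θ-leibniz f g zero = trans (zeroˡ _) (sym (trans (+-cong (trans (*-congʳ (zeroˡ _)) (zeroˡ _))
     (trans (*-congˡ (zeroˡ _)) (zeroʳ _))) (+-identityʳ _)))
  θ-leibniz f g (suc n) = begin
    (1# + k) * (f 0 * g (suc n) + (tail f *ₛ g) n)
      ≈⟨ expand k (f 0) (g (suc n)) _ ⟩
    (f 0 * ((1# + k) * g (suc n)) + (tail f *ₛ g) n) + k * (tail f *ₛ g) n
      ≈⟨ +-congˡ (θ-leibniz (tail f) g n) ⟩
    (f 0 * ((1# + k) * g (suc n)) + (tail f *ₛ g) n) + ((θ (tail f) *ₛ g) n + (tail f *ₛ θ g) n)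
      ≈⟨ regroup _ _ _ _ ⟩
    ((θ (tail f) *ₛ g) n + (tail f *ₛ g) n) + (f 0 * ((1# + k) * g (suc n)) + (tail f *ₛ θ g) n)
      ≈⟨ +-congʳ (sym (*ₛ-distribʳ (θ (tail f)) (tail f) g n)) ⟩
    ((θ (tail f) +ₛ tail f) *ₛ g) n + (f 0 * ((1# + k) * g (suc n)) + (tail f *ₛ θ g) n)
      ≈⟨ +-congʳ (sym (*ₛ-cong (tail-θ f) ≋-refl n)) ⟩
    (tail (θ f) *ₛ g) n + (f 0 * ((1# + k) * g (suc n)) + (tail f *ₛ θ g) n)
      ≈⟨ +-congʳ (sym (trans (+-congʳ (trans (*-congʳ (zeroˡ _)) (zeroˡ _))) (+-identityˡ _))) ⟩
    ((0# * f 0) * g (suc n) + (tail (θ f) *ₛ g) n) + (f 0 * ((1# + k) * g (suc n)) + (tail f *ₛ θ g) n) ∎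
    where
    k = fromℕ n
    expand : ∀ k x y t → (1# + k) * (x * y + t) ≈ (x * ((1# + k) * y) + t) + k * t
    expand = solve 4 (λ k x y t → ((con 1 :+ k) :* (x :* y :+ t)) := ((x :* ((con 1 :+ k) :* y) :+ t) :+ k :* t)) refl
    regroup : ∀ a t x y → (a + t) + (x + y) ≈ (x + t) + (a + y)
    regroup = solve 4 (λ a t x y → ((a :+ t) :+ (x :+ y)) := ((x :+ t) :+ (a :+ y))) refl

  finSum : (ℕ → Carrier) → ℕ → Carrier
  finSum h zero = h 0
  finSum h (suc n) = finSum h n + h (suc n)

  finSum-unroll : ∀ h n → finSum h (suc n) ≈ h 0 + finSum (λ i → h (suc i)) n
  finSum-unroll h zero = refl
  finSum-unroll h (suc n) = trans (+-congʳ (finSum-unroll h n)) (+-assoc _ _ _)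

  finSum-cong : ∀ {h h'} n → (∀ i → i ≤ n → h i ≈ h' i) → finSum h n ≈ finSum h' n
  finSum-cong zero p = p 0 z≤n
  finSum-cong (suc n) p = +-cong (finSum-cong n (λ i i≤n → p i (ℕP.m≤n⇒m≤1+n i≤n))) (p (suc n) ℕP.≤-refl)

  finSum-* : ∀ a h n → a * finSum h n ≈ finSum (λ i → a * h i) n
  finSum-* a h zero = refl
  finSum-* a h (suc n) = trans (distribˡ _ _ _) (+-congʳ (finSum-* a h n))

  finSum-vanishing-tail : ∀ h m n → m ≤ n → (∀ i → m < i → i ≤ n → h i ≈ 0#) → finSum h n ≈ finSum h m
  finSum-vanishing-tail h m zero z≤n _ = refl
  finSum-vanishing-tail h m (suc n) m≤sn z with ℕP.m≤n⇒m<n∨m≡n m≤sn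
  ... | inj₂ P.refl = refl
  ... | inj₁ (s≤s m≤n) = trans (+-cong (finSum-vanishing-tail h m n m≤n (λ i m<i i≤n → z i m<i (ℕP.m≤n⇒m≤1+n i≤n)))
                                     (z (suc n) (s≤s m≤n) ℕP.≤-refl)) (+-identityʳ _)

  *ₛ-as-finSum : ∀ f g n → (f *ₛ g) n ≈ finSum (λ i → f i * g (n ∸ i)) n
  *ₛ-as-finSum f g zero = refl
  *ₛ-as-finSum f g (suc n) = trans (+-congˡ (*ₛ-as-finSum (tail f) g n)) (sym (finSum-unroll (λ i → f i * g (suc n ∸ i)) n))

  *ₛ-unit-below : ∀ A F m → F 0 ≈ 1# → (∀ i → 0 < i → i ≤ m → F i ≈ 0#) → (A *ₛ F) m ≈ A m
  *ₛ-unit-below A F zero p q = trans (*-congˡ p) (*-identityʳ _)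
  *ₛ-unit-below A F (suc m) p q = trans (+-cong (trans (*-congˡ (q (suc m) (s≤s z≤n) ℕP.≤-refl)) (zeroʳ _))
    (*ₛ-unit-below (tail A) F m p (λ i 0<i i≤m → q i 0<i (ℕP.m≤n⇒m≤1+n i≤m)))) (+-identityˡ _)

  shift1 : Ser → Ser
  shift1 f zero = 0#
  shift1 f (suc n) = f n

  shift : ℕ → Ser → Ser
  shift zero f = f
  shift (suc k) f = shift1 (shift k f)

  shift1-cong : ∀ {f g} → f ≋ g → shift1 f ≋ shift1 g
  shift1-cong p zero = refl
  shift1-cong p (suc n) = p n

  shift-cong : ∀ k {f g} → f ≋ g → shift k f ≋ shift k g
  shift-cong zero p = p
  shift-cong (suc k) p = shift1-cong (shift-cong k p)

  shift1-*ₛ : ∀ f g → shift1 f *ₛ g ≋ shift1 (f *ₛ g)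
  shift1-*ₛ f g zero = zeroˡ _
  shift1-*ₛ f g (suc n) = trans (+-congʳ (zeroˡ _)) (+-identityˡ _)

  shift-*ₛ : ∀ k f g → shift k f *ₛ g ≋ shift k (f *ₛ g)
  shift-*ₛ zero f g = ≋-refl
  shift-*ₛ (suc k) f g = ≋-trans (shift1-*ₛ (shift k f) g) (shift1-cong (shift-*ₛ k f g))

  shift-+ : ∀ k f g → shift k (f +ₛ g) ≋ shift k f +ₛ shift k g
  shift-+ zero f g = ≋-refl
  shift-+ (suc k) f g zero = sym (+-identityʳ _)
  shift-+ (suc k) f g (suc n) = shift-+ k f g n

  shift-∙ : ∀ k a f → shift k (a ∙ f) ≋ a ∙ shift k f
  shift-∙ zero a f = ≋-refl
  shift-∙ (suc k) a f zero = sym (zeroʳ _)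
  shift-∙ (suc k) a f (suc n) = shift-∙ k a f n

  shift-below : ∀ k f n → n < k → shift k f n ≈ 0#
  shift-below (suc k) f zero _ = refl
  shift-below (suc k) f (suc n) (s≤s n<k) = shift-below k f n n<k

  shift-above : ∀ k f m → shift k f (k ℕ.+ m) ≈ f m
  shift-above zero f m = refl
  shift-above (suc k) f m = shift-above k f m

  _≈<_>_ : Ser → ℕ → Ser → Set ℓ
  f ≈< M > g = ∀ i → i < M → f i ≈ g i

  shift-agree : ∀ k {f g M} → f ≈< M > g → shift k f ≈< M > shift k g
  shift-agree zero p = p
  shift-agree (suc k) p zero _ = refl
  shift-agree (suc k) {M = M} p (suc i) i<M = shift-agree k p i (ℕP.<-trans (ℕP.n<1+n i) i<M)

  shift1-agree : ∀ {f g M} → f ≈< M > g → shift1 f ≈< suc M > shift1 g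
  shift1-agree p zero _ = refl
  shift1-agree p (suc i) (s≤s i<M) = p i i<M

  ≡⇒≈ : ∀ {x y} → x ≡ y → x ≈ y
  ≡⇒≈ P.refl = refl

  -- The dilation q ↦ q^(j+1):  dilate j f = Σ_n f n · q^((j+1)·n).
  dilate : ℕ → Ser → Ser
  dilate j f n with suc j ∣? n
  ... | yes _ = f (n / suc j)
  ... | no  _ = 0#

  dilate-∣ : ∀ j f n → suc j ∣ n → dilate j f n ≡ f (n / suc j)
  dilate-∣ j f n d with suc j ∣? n
  ... | yes _ = P.refl
  ... | no ¬d = ⊥-elim (¬d d)

  dilate-∤ : ∀ j f n → ¬ (suc j ∣ n) → dilate j f n ≡ 0#
  dilate-∤ j f n ¬d with suc j ∣? n
  ... | yes d = ⊥-elim (¬d d)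
  ... | no _ = P.refl

  dilate-cong : ∀ j {f g} → f ≋ g → dilate j f ≋ dilate j g
  dilate-cong j {f} {g} p n = by-cases (suc j ∣? n)
    where
    by-cases : Dec (suc j ∣ n) → dilate j f n ≈ dilate j g n
    by-cases (yes d) = trans (≡⇒≈ (dilate-∣ j f n d)) (trans (p _) (sym (≡⇒≈ (dilate-∣ j g n d))))
    by-cases (no ¬d) = trans (≡⇒≈ (dilate-∤ j f n ¬d)) (sym (≡⇒≈ (dilate-∤ j g n ¬d)))

  dilate-+ : ∀ j f g → dilate j (f +ₛ g) ≋ dilate j f +ₛ dilate j g
  dilate-+ j f g n = by-cases (suc j ∣? n)
    where
    by-cases : Dec (suc j ∣ n) → dilate j (f +ₛ g) n ≈ dilate j f n + dilate j g n
    by-cases (yes d) = trans (≡⇒≈ (dilate-∣ j _ n d)) (sym (+-cong (≡⇒≈ (dilate-∣ j f n d)) (≡⇒≈ (dilate-∣ j g n d))))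
    by-cases (no ¬d) = trans (≡⇒≈ (dilate-∤ j _ n ¬d))
      (sym (trans (+-cong (≡⇒≈ (dilate-∤ j f n ¬d)) (≡⇒≈ (dilate-∤ j g n ¬d))) (+-identityʳ _)))

  dilate-∙ : ∀ j a f → dilate j (a ∙ f) ≋ a ∙ dilate j f
  dilate-∙ j a f n = by-cases (suc j ∣? n)
    where
    by-cases : Dec (suc j ∣ n) → dilate j (a ∙ f) n ≈ a * dilate j f n
    by-cases (yes d) = trans (≡⇒≈ (dilate-∣ j _ n d)) (sym (*-congˡ (≡⇒≈ (dilate-∣ j f n d))))
    by-cases (no ¬d) = trans (≡⇒≈ (dilate-∤ j _ n ¬d)) (sym (trans (*-congˡ (≡⇒≈ (dilate-∤ j f n ¬d))) (zeroʳ _)))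

  dilate-above : ∀ j f m → dilate j f (suc j ℕ.+ m) ≈ dilate j (tail f) m
  dilate-above j f m = by-cases (suc j ∣? m)
    where
    J = suc j
    quotient : (J ℕ.+ m) / J ≡ suc (m / J)
    quotient = P.trans (ℕM.m/n≡1+[m∸n]/n (ℕP.m≤m+n J m)) (P.cong (λ x → suc (x / J)) (ℕP.m+n∸m≡n J m))
    by-cases : Dec (J ∣ m) → dilate j f (J ℕ.+ m) ≈ dilate j (tail f) m
    by-cases (yes d) = trans (≡⇒≈ (dilate-∣ j f _ (ℕD.∣m∣n⇒∣m+n ℕD.∣-refl d)))
                         (trans (≡⇒≈ (P.cong f quotient)) (sym (≡⇒≈ (dilate-∣ j (tail f) m d))))
    by-cases (no ¬d) = trans (≡⇒≈ (dilate-∤ j f _ (λ d → ¬d (ℕD.∣m+n∣m⇒∣n d ℕD.∣-refl))))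
                         (sym (≡⇒≈ (dilate-∤ j _ m ¬d)))

  dilate-unroll : ∀ j f → dilate j f ≋ const (f 0) +ₛ shift (suc j) (dilate j (tail f))
  dilate-unroll j f zero = trans (≡⇒≈ (dilate-∣ j f 0 (ℕD.divides 0 P.refl))) (sym (+-identityʳ _))
  dilate-unroll j f (suc n) with suc n ℕP.<? suc j
  ... | yes n<J = trans (≡⇒≈ (dilate-∤ j f _ (λ d → ℕP.<⇒≱ n<J (ℕD.∣⇒≤ d))))
                    (sym (trans (+-congˡ (shift-below (suc j) _ _ n<J)) (+-identityʳ _)))
  ... | no n≮J = P.subst (λ k → dilate j f k ≈ (const (f 0) +ₛ shift (suc j) (dilate j (tail f))) k)
                   (ℕP.m+[n∸m]≡n (ℕP.≮⇒≥ n≮J))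
                   (trans (dilate-above j f m) (sym (trans (+-identityˡ _) (shift-above (suc j) _ m))))
    where m = suc n ∸ suc j

  -- Both sides of dilate-*ₛ have the same unrolling, up to the remaining
  -- product inside the shift.
  private
    dilate-*ₛ-unrollˡ : ∀ j f g → dilate j (f *ₛ g) ≋
      const (f 0 * g 0) +ₛ shift (suc j) (f 0 ∙ dilate j (tail g) +ₛ dilate j (tail f *ₛ g))
    dilate-*ₛ-unrollˡ j f g = ≋-trans (dilate-unroll j (f *ₛ g)) (+ₛ-cong ≋-refl (shift-cong (suc j)
      (≋-trans (dilate-cong j {f = tail (f *ₛ g)} {g = f 0 ∙ tail g +ₛ tail f *ₛ g} (λ _ → refl))
        (≋-trans (dilate-+ j _ _) (+ₛ-cong (dilate-∙ j (f 0) (tail g)) ≋-refl)))))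

    dilate-*ₛ-unrollʳ : ∀ j f g → dilate j f *ₛ dilate j g ≋
      const (f 0 * g 0) +ₛ shift (suc j) (f 0 ∙ dilate j (tail g) +ₛ dilate j (tail f) *ₛ dilate j g)
    dilate-*ₛ-unrollʳ j f g =
      ≋-trans (*ₛ-cong (dilate-unroll j f) ≋-refl)
      (≋-trans (*ₛ-distribʳ _ _ _)
      (≋-trans (+ₛ-cong (const*ₛ (f 0) (dilate j g)) (shift-*ₛ J (dilate j (tail f)) (dilate j g)))
      (≋-trans (+ₛ-cong (∙-cong refl (dilate-unroll j g)) ≋-refl)
      (≋-trans (+ₛ-cong (≋-trans (∙-+ₛ (f 0) _ _) (+ₛ-cong (∙-const (f 0) (g 0)) (≋-sym (shift-∙ J (f 0) _)))) ≋-refl)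
      (≋-trans (λ n → +-assoc _ _ _) (+ₛ-cong ≋-refl (≋-sym (shift-+ J _ _))))))))
      where J = suc j

    -- Induction on the number M of coefficients compared.
    dilate-*ₛ-below : ∀ j M f g → dilate j (f *ₛ g) ≈< M > (dilate j f *ₛ dilate j g)
    dilate-*ₛ-below j zero f g i ()
    dilate-*ₛ-below j (suc M) f g i i<M =
      trans (dilate-*ₛ-unrollˡ j f g i) (trans (+-congˡ inner) (sym (dilate-*ₛ-unrollʳ j f g i)))
      where
      inner = shift1-agree (shift-agree j (λ k k<M → +-congˡ (dilate-*ₛ-below j M (tail f) g k k<M))) i i<M

  dilate-*ₛ : ∀ j f g → dilate j (f *ₛ g) ≋ dilate j f *ₛ dilate j g
  dilate-*ₛ j f g n = dilate-*ₛ-below j (suc n) f g n ℕP.≤-refl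

  θ-dilate : ∀ j f → θ (dilate j f) ≋ fromℕ (suc j) ∙ dilate j (θ f)
  θ-dilate j f n = by-cases (suc j ∣? n)
    where
    by-cases : Dec (suc j ∣ n) → fromℕ n * dilate j f n ≈ fromℕ (suc j) * dilate j (θ f) n
    by-cases (yes d) = begin
        fromℕ n * dilate j f n ≈⟨ *-congˡ (≡⇒≈ (dilate-∣ j f n d)) ⟩
        fromℕ n * f q ≈⟨ *-congʳ (≡⇒≈ (P.cong fromℕ (P.sym (ℕM.m/n*n≡m d)))) ⟩
        fromℕ (q ℕ.* suc j) * f q ≈⟨ *-congʳ (fromℕ-* q (suc j)) ⟩
        (fromℕ q * fromℕ (suc j)) * f q ≈⟨ solve 3 (λ a b x → ((a :* b) :* x) := (b :* (a :* x))) refl _ _ _ ⟩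
        fromℕ (suc j) * (fromℕ q * f q) ≈⟨ *-congˡ (sym (≡⇒≈ (dilate-∣ j (θ f) n d))) ⟩
        fromℕ (suc j) * dilate j (θ f) n ∎
      where q = n / suc j
    by-cases (no ¬d) = trans (*-congˡ (≡⇒≈ (dilate-∤ j f n ¬d)))
      (trans (zeroʳ _) (sym (trans (*-congˡ (≡⇒≈ (dilate-∤ j (θ f) n ¬d))) (zeroʳ _))))


-- The embedding ι : ℤ → ℚ is an injective ring homomorphism; we transport
-- every computation through unnormalised rationals, where it is trivial.
module RationalEmbedding where

  open import Data.Nat as ℕ using (ℕ; suc; _!)
  open import Data.Nat.Properties using (_!≢0)
  open import Data.Integer as ℤ using (ℤ; +_)
  import Data.Integer.Properties as ℤP
  import Data.Nat.Properties as ℕP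
  open import Data.Rational as ℚ using (ℚ; _/_; toℚᵘ)
  import Data.Rational.Properties as ℚP
  open import Data.Rational.Unnormalised as ℚᵘ using (mkℚᵘ; *≡*; _≃_)
  import Data.Rational.Unnormalised.Properties as ℚᵘP
  open ℚᵘP using (≃-sym)
  open import Relation.Binary.PropositionalEquality

  ι : ℤ → ℚ
  ι z = z / 1

  toℚᵘ-/ : ∀ z d → toℚᵘ (z / suc d) ≃ mkℚᵘ z d
  toℚᵘ-/ z d = ℚP.toℚᵘ-fromℚᵘ (mkℚᵘ z d)

  ι-+ : ∀ x y → ι (x ℤ.+ y) ≡ ι x ℚ.+ ι y
  ι-+ x y = ℚP.toℚᵘ-injective (begin
    toℚᵘ (ι (x ℤ.+ y))         ≈⟨ toℚᵘ-/ (x ℤ.+ y) 0 ⟩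
    mkℚᵘ (x ℤ.+ y) 0           ≈⟨ *≡* (trans (ℤP.*-identityʳ _) (sym (trans (ℤP.*-identityʳ _)
                                     (cong₂ ℤ._+_ (ℤP.*-identityʳ x) (ℤP.*-identityʳ y))))) ⟩
    mkℚᵘ x 0 ℚᵘ.+ mkℚᵘ y 0     ≈⟨ ℚᵘP.+-cong (≃-sym (toℚᵘ-/ x 0)) (≃-sym (toℚᵘ-/ y 0)) ⟩
    toℚᵘ (ι x) ℚᵘ.+ toℚᵘ (ι y) ≈⟨ ≃-sym (ℚP.toℚᵘ-homo-+ (ι x) (ι y)) ⟩
    toℚᵘ (ι x ℚ.+ ι y)         ∎)
    where open ℚᵘP.≃-Reasoning

  ι-* : ∀ x y → ι (x ℤ.* y) ≡ ι x ℚ.* ι y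
  ι-* x y = ℚP.toℚᵘ-injective (begin
    toℚᵘ (ι (x ℤ.* y))         ≈⟨ toℚᵘ-/ (x ℤ.* y) 0 ⟩
    mkℚᵘ (x ℤ.* y) 0           ≈⟨ *≡* refl ⟩
    mkℚᵘ x 0 ℚᵘ.* mkℚᵘ y 0     ≈⟨ ℚᵘP.*-cong (≃-sym (toℚᵘ-/ x 0)) (≃-sym (toℚᵘ-/ y 0)) ⟩
    toℚᵘ (ι x) ℚᵘ.* toℚᵘ (ι y) ≈⟨ ≃-sym (ℚP.toℚᵘ-homo-* (ι x) (ι y)) ⟩
    toℚᵘ (ι x ℚ.* ι y)         ∎)
    where open ℚᵘP.≃-Reasoning

  ι-injective : ∀ {x y} → ι x ≡ ι y → x ≡ y
  ι-injective {x} {y} eq with ℚᵘP.≃-trans (≃-sym (toℚᵘ-/ x 0)) (ℚᵘP.≃-trans (ℚP.toℚᵘ-cong eq) (toℚᵘ-/ y 0))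
  ... | *≡* e = trans (sym (ℤP.*-identityʳ x)) (trans e (ℤP.*-identityʳ y))

  cancel-1/ : ∀ r a → (+ suc r / 1) ℚ.* (+ 1 / (suc r ℕ.* suc a)) ≡ + 1 / suc a
  cancel-1/ r a = ℚP.toℚᵘ-injective (begin
    toℚᵘ ((+ suc r / 1) ℚ.* (+ 1 / (suc r ℕ.* suc a)))
      ≈⟨ ℚP.toℚᵘ-homo-* (+ suc r / 1) (+ 1 / (suc r ℕ.* suc a)) ⟩
    toℚᵘ (+ suc r / 1) ℚᵘ.* toℚᵘ (+ 1 / (suc r ℕ.* suc a))
      ≈⟨ ℚᵘP.*-cong (toℚᵘ-/ (+ suc r) 0) (toℚᵘ-/ (+ 1) (a ℕ.+ r ℕ.* suc a)) ⟩
    mkℚᵘ (+ suc r) 0 ℚᵘ.* mkℚᵘ (+ 1) (a ℕ.+ r ℕ.* suc a)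
      ≈⟨ *≡* (cong (λ t → + suc t) (trans (cong (λ t → a ℕ.+ t ℕ.* suc a) (ℕP.*-identityʳ r))
               (sym (trans (ℕP.+-identityʳ _) (ℕP.+-identityʳ _))))) ⟩
    mkℚᵘ (+ 1) a
      ≈⟨ ≃-sym (toℚᵘ-/ (+ 1) a) ⟩
    toℚᵘ (+ 1 / suc a) ∎)
    where open ℚᵘP.≃-Reasoning

  inverse-factorial-step : ∀ r → (+ suc r / 1) ℚ.* ((+ 1 / (suc r !)) {{suc r !≢0}}) ≡ (+ 1 / (r !)) {{r !≢0}}
  inverse-factorial-step r = go (r !) {{r !≢0}} {{suc r !≢0}}
    where
    go : ∀ n .{{_ : ℕ.NonZero n}} .{{_ : ℕ.NonZero (suc r ℕ.* n)}} →
         (+ suc r / 1) ℚ.* (+ 1 / (suc r ℕ.* n)) ≡ + 1 / n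
    go (suc a) = cancel-1/ r a


-- Polynomials in b are viewed
-- as power series in b (ring ℚ[[b]], module B) and the q-series of Defs as
-- power series in q over ℚ[[b]] (module Q).
module ProductSeries where

  open import Defs
  open RationalEmbedding
  open import Algebra using (CommutativeRing)
  open import Data.Nat as ℕ using (ℕ; zero; suc; _∸_; _≤_; _<_; z≤n; s≤s; _!)
  import Data.Nat.Properties as ℕP
  open ℕP using (_!≢0)
  open import Data.Nat.Divisibility as ℕD using (_∣_; _∣?_)
  open import Data.Integer using (+_)
  open import Data.Rational as ℚ using (ℚ; 0ℚ; 1ℚ)
  import Data.Rational.Properties as ℚP
  open import Data.List using ([]; _∷_)
  open import Relation.Binary.PropositionalEquality
  open import Relation.Nullary using (yes; no; ¬_; Dec)
  open import Data.Empty using (⊥-elim)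
  open import Data.Sum using (inj₁; inj₂)

  module B = PowerSeries ℚP.+-*-commutativeRing
  module Q = PowerSeries B.seriesRing
  module RB = CommutativeRing B.seriesRing
  module RQ = CommutativeRing Q.seriesRing

  open B using () renaming (_≋_ to _≋ᵇ_; _+ₛ_ to _+ᵇ_; _*ₛ_ to _*ᵇ_; _∙_ to _∙ᵇ_)
  open Q using () renaming (_≋_ to _≋ᑫ_; _+ₛ_ to _+ᑫ_; _*ₛ_ to _*ᑫ_; _∙_ to _∙ᑫ_)

  ≡⇒≋ᵇ : ∀ {f g : B.Ser} → f ≡ g → f ≋ᵇ g
  ≡⇒≋ᵇ refl _ = refl

  ∙ᵇ-congˡ : ∀ x {f g} → f ≋ᵇ g → (x ∙ᵇ f) ≋ᵇ (x ∙ᵇ g)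
  ∙ᵇ-congˡ x p = B.∙-cong {a = x} refl p

  ∙ᵇ-assoc : ∀ x y f → (x ∙ᵇ (y ∙ᵇ f)) ≋ᵇ ((x ℚ.* y) ∙ᵇ f)
  ∙ᵇ-assoc x y f n = sym (ℚP.*-assoc x y (f n))

  coeff-+ᴾ : ∀ p q → coeff (p +ᴾ q) ≋ᵇ (coeff p +ᵇ coeff q)
  coeff-+ᴾ [] q n = sym (ℚP.+-identityˡ _)
  coeff-+ᴾ (a ∷ p) [] n = sym (ℚP.+-identityʳ _)
  coeff-+ᴾ (a ∷ p) (b ∷ q) zero = refl
  coeff-+ᴾ (a ∷ p) (b ∷ q) (suc n) = coeff-+ᴾ p q n

  coeff-scaleᴾ : ∀ c p → coeff (scaleᴾ c p) ≋ᵇ (c ∙ᵇ coeff p)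
  coeff-scaleᴾ c [] n = sym (ℚP.*-zeroʳ c)
  coeff-scaleᴾ c (a ∷ p) zero = refl
  coeff-scaleᴾ c (a ∷ p) (suc n) = coeff-scaleᴾ c p n

  coeff-*ᴾ : ∀ p q → coeff (p *ᴾ q) ≋ᵇ (coeff p *ᵇ coeff q)
  coeff-*ᴾ [] q n = sym (B.0ₛ*ₛ (coeff q) n)
  coeff-*ᴾ (a ∷ p) q zero = trans (coeff-+ᴾ (scaleᴾ a q) (0ℚ ∷ (p *ᴾ q)) 0)
    (trans (ℚP.+-identityʳ _) (coeff-scaleᴾ a q 0))
  coeff-*ᴾ (a ∷ p) q (suc n) = trans (coeff-+ᴾ (scaleᴾ a q) (0ℚ ∷ (p *ᴾ q)) (suc n))
    (cong₂ ℚ._+_ (coeff-scaleᴾ a q (suc n)) (coeff-*ᴾ p q n))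

  coeff-sumTo : ∀ h n → coeff (sumTo h n) ≋ᵇ Q.finSum (λ i → coeff (h i)) n
  coeff-sumTo h zero = λ _ → refl
  coeff-sumTo h (suc n) = B.≋-trans (coeff-+ᴾ (sumTo h n) (h (suc n))) (B.+ₛ-cong (coeff-sumTo h n) (λ _ → refl))

  toSer : Series → Q.Ser
  toSer f n = coeff (f n)

  toSer-* : ∀ f g → toSer (f *ˢ g) ≋ᑫ (toSer f *ᑫ toSer g)
  toSer-* f g n = B.≋-trans (coeff-sumTo _ n)
    (B.≋-trans (Q.finSum-cong n (λ i _ → coeff-*ᴾ (f i) (g (n ∸ i)))) (B.≋-sym (Q.*ₛ-as-finSum (toSer f) (toSer g) n)))

  toSer-oneˢ : toSer oneˢ ≋ᑫ Q.1ₛ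
  toSer-oneˢ zero zero = refl
  toSer-oneˢ zero (suc e) = refl
  toSer-oneˢ (suc n) e = refl

  fromℕ-const : ∀ n → Q.fromℕ n ≋ᵇ B.const (ι (+ n))
  fromℕ-const zero zero = refl
  fromℕ-const zero (suc e) = refl
  fromℕ-const (suc n) zero = trans (cong (1ℚ ℚ.+_) (fromℕ-const n 0)) (sym (ι-+ (+ 1) (+ n)))
  fromℕ-const (suc n) (suc e) = trans (cong (0ℚ ℚ.+_) (fromℕ-const n (suc e))) (ℚP.+-identityˡ _)

  fromℕ-*ᵇ : ∀ n f → (Q.fromℕ n *ᵇ f) ≋ᵇ (ι (+ n) ∙ᵇ f)
  fromℕ-*ᵇ n f = B.≋-trans (B.*ₛ-cong (fromℕ-const n) B.≋-refl) (B.const*ₛ (ι (+ n)) f)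

  1-b : B.Ser
  1-b = coeff (1ℚ ∷ ℚ.- 1ℚ ∷ [])

  -- The binomial series (1-q)^(b-1) = Σ_r (-1)^r C(b-1,r) q^r.
  binomialSeries : Q.Ser
  binomialSeries r = coeff (scaleᴾ (sign r) (binomᴾ r))

  inverseFactorial : ℕ → ℚ
  inverseFactorial r = (+ 1 ℚ./ (r !)) {{r !≢0}}

  binomialSeries-falling : ∀ r → binomialSeries r ≋ᵇ ((sign r ℚ.* inverseFactorial r) ∙ᵇ coeff (fallingᴾ r))
  binomialSeries-falling r = B.≋-trans (coeff-scaleᴾ (sign r) (scaleᴾ (inverseFactorial r) (fallingᴾ r)))
    (B.≋-trans (∙ᵇ-congˡ (sign r) (coeff-scaleᴾ (inverseFactorial r) (fallingᴾ r)))
               (∙ᵇ-assoc (sign r) (inverseFactorial r) (coeff (fallingᴾ r))))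

  ratio : ℕ → B.Ser
  ratio r = 1-b +ᵇ Q.fromℕ r

  coeff-fallingFactor : ∀ r → coeff ((ℚ.- (+ suc r ℚ./ 1)) ∷ 1ℚ ∷ []) ≋ᵇ (ℚ.- 1ℚ) ∙ᵇ ratio r
  coeff-fallingFactor r zero = begin
      ℚ.- (+ suc r ℚ./ 1)              ≡⟨ cong ℚ.-_ (ι-+ (+ 1) (+ r)) ⟩
      ℚ.- (1ℚ ℚ.+ ι (+ r))             ≡⟨ solve 1 (λ x → (:- (con 1ℚ :+ x)) := (con (ℚ.- 1ℚ) :* (con 1ℚ :+ x))) refl (ι (+ r)) ⟩
      ℚ.- 1ℚ ℚ.* (1ℚ ℚ.+ ι (+ r))      ≡⟨ cong (λ t → ℚ.- 1ℚ ℚ.* (1ℚ ℚ.+ t)) (sym (fromℕ-const r 0)) ⟩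
      ℚ.- 1ℚ ℚ.* (1ℚ ℚ.+ Q.fromℕ r 0) ∎
    where
    open ≡-Reasoning
    open import Data.Rational.Solver
    open +-*-Solver
  coeff-fallingFactor r (suc zero) = trans (sym (ℚP.*-identityˡ 1ℚ))
    (cong (λ t → ℚ.- 1ℚ ℚ.* (ℚ.- 1ℚ ℚ.+ t)) (sym (fromℕ-const r 1)))
  coeff-fallingFactor r (suc (suc e)) = sym (cong (λ t → ℚ.- 1ℚ ℚ.* (0ℚ ℚ.+ t)) (fromℕ-const r (suc (suc e))))

  binomialSeries-ratio : ∀ r → (Q.fromℕ (suc r) *ᵇ binomialSeries (suc r)) ≋ᵇ (ratio r *ᵇ binomialSeries r)
  binomialSeries-ratio r = B.≋-trans (fromℕ-*ᵇ (suc r) (binomialSeries (suc r)))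
    (B.≋-trans lhs-closed (B.≋-sym rhs-closed))
    where
    F = coeff (fallingᴾ r)
    s = sign r
    x = ι (+ suc r)
    s' = sign (suc r) ℚ.* inverseFactorial (suc r)
    scalar : x ℚ.* ((ℚ.- s ℚ.* inverseFactorial (suc r)) ℚ.* ℚ.- 1ℚ) ≡ s ℚ.* inverseFactorial r
    scalar = trans (solve 3 (λ x s y → (x :* ((:- s :* y) :* con (ℚ.- 1ℚ))) := (s :* (x :* y))) refl x s (inverseFactorial (suc r)))
                   (cong (s ℚ.*_) (inverse-factorial-step r))
      where open import Data.Rational.Solver
            open +-*-Solver
    lhs-closed : (x ∙ᵇ binomialSeries (suc r)) ≋ᵇ ((s ℚ.* inverseFactorial r) ∙ᵇ (F *ᵇ ratio r))
    lhs-closed = B.≋-trans (∙ᵇ-congˡ x (binomialSeries-falling (suc r)))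
      (B.≋-trans (∙ᵇ-congˡ x (∙ᵇ-congˡ s' (coeff-*ᴾ (fallingᴾ r) _)))
      (B.≋-trans (∙ᵇ-congˡ x (∙ᵇ-congˡ s' (B.*ₛ-cong B.≋-refl (coeff-fallingFactor r))))
      (B.≋-trans (∙ᵇ-congˡ x (∙ᵇ-congˡ s' (B.*ₛ-∙ (ℚ.- 1ℚ) F (ratio r))))
      (B.≋-trans (∙ᵇ-congˡ x (∙ᵇ-assoc s' (ℚ.- 1ℚ) _))
      (B.≋-trans (∙ᵇ-assoc x _ _) (B.∙-cong scalar B.≋-refl))))))
    rhs-closed : (ratio r *ᵇ binomialSeries r) ≋ᵇ ((s ℚ.* inverseFactorial r) ∙ᵇ (F *ᵇ ratio r))
    rhs-closed = B.≋-trans (B.*ₛ-cong B.≋-refl (binomialSeries-falling r))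
      (B.≋-trans (B.*ₛ-∙ (s ℚ.* inverseFactorial r) (ratio r) F) (∙ᵇ-congˡ (s ℚ.* inverseFactorial r) (B.*ₛ-comm (ratio r) F)))

  q/[1-q] : Q.Ser
  q/[1-q] zero = B.0ₛ
  q/[1-q] (suc _) = B.1ₛ

  1/[1-q] : Q.Ser
  1/[1-q] _ = B.1ₛ

  -- Telescoping binomialSeries-ratio, with a = binomialSeries:
  -- (r+1) a_(r+1) = (1-b) (a_0 + ... + a_r).
  binomialSeries-partialSums : ∀ r → (Q.fromℕ (suc r) *ᵇ binomialSeries (suc r)) ≋ᵇ (1-b *ᵇ (1/[1-q] *ᑫ binomialSeries) r)
  binomialSeries-partialSums zero = B.≋-trans (binomialSeries-ratio 0)
    (B.≋-trans (B.*ₛ-cong (RB.+-identityʳ 1-b) B.≋-refl) (B.*ₛ-cong B.≋-refl (B.≋-sym (B.1ₛ*ₛ (binomialSeries 0)))))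
  binomialSeries-partialSums (suc r) = B.≋-trans (binomialSeries-ratio (suc r))
    (B.≋-trans (RB.distribʳ a' 1-b (Q.fromℕ (suc r)))
    (B.≋-trans (B.+ₛ-cong {f = 1-b *ᵇ a'} B.≋-refl (binomialSeries-partialSums r))
    (B.≋-trans (B.≋-sym (RB.distribˡ 1-b a' ((1/[1-q] *ᑫ binomialSeries) r)))
    (B.*ₛ-cong B.≋-refl (B.+ₛ-cong (B.≋-sym (B.1ₛ*ₛ a')) B.≋-refl)))))
    where a' = binomialSeries (suc r)

  θ-binomialSeries : Q.θ binomialSeries ≋ᑫ (1-b ∙ᑫ (q/[1-q] *ᑫ binomialSeries))
  θ-binomialSeries zero = B.≋-trans (B.0ₛ*ₛ (binomialSeries 0))
    (B.≋-sym (B.≋-trans (B.*ₛ-cong B.≋-refl (B.0ₛ*ₛ (binomialSeries 0))) (RB.zeroʳ 1-b)))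
  θ-binomialSeries (suc r) = B.≋-trans (binomialSeries-partialSums r) (B.*ₛ-cong B.≋-refl (B.≋-sym
    (B.≋-trans (B.+ₛ-cong (B.0ₛ*ₛ (binomialSeries (suc r))) B.≋-refl) (RB.+-identityˡ _))))

  factorˢ-∣ : ∀ j n → suc j ∣ n → factorˢ j n ≡ scaleᴾ (sign (n ℕ./ suc j)) (binomᴾ (n ℕ./ suc j))
  factorˢ-∣ j n d with suc j ∣? n
  ... | yes _ = refl
  ... | no ¬d = ⊥-elim (¬d d)

  factorˢ-∤ : ∀ j n → ¬ (suc j ∣ n) → factorˢ j n ≡ []
  factorˢ-∤ j n ¬d with suc j ∣? n
  ... | yes d = ⊥-elim (¬d d)
  ... | no _ = refl

  factor-dilate : ∀ j → toSer (factorˢ j) ≋ᑫ Q.dilate j binomialSeries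
  factor-dilate j n = by-cases (suc j ∣? n)
    where
    by-cases : Dec (suc j ∣ n) → toSer (factorˢ j) n ≋ᵇ Q.dilate j binomialSeries n
    by-cases (yes d) = B.≋-trans (≡⇒≋ᵇ (cong coeff (factorˢ-∣ j n d))) (≡⇒≋ᵇ (sym (Q.dilate-∣ j binomialSeries n d)))
    by-cases (no ¬d) = B.≋-trans (≡⇒≋ᵇ (cong coeff (factorˢ-∤ j n ¬d))) (≡⇒≋ᵇ (sym (Q.dilate-∤ j binomialSeries n ¬d)))

  -- (j+1) q^(j+1) / (1 - q^(j+1)), the logarithmic derivative of the j-th factor
  -- up to the constant 1-b.
  logDerivTerm : ℕ → Q.Ser
  logDerivTerm j = Q.fromℕ (suc j) ∙ᑫ Q.dilate j q/[1-q]

  ∙ᑫ-swap : ∀ x y f → (x ∙ᑫ (y ∙ᑫ f)) ≋ᑫ (y ∙ᑫ (x ∙ᑫ f))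
  ∙ᑫ-swap x y f n = B.≋-trans (B.≋-sym (RB.*-assoc x y (f n)))
    (B.≋-trans (RB.*-congʳ (RB.*-comm x y)) (RB.*-assoc y x (f n)))

  θ-factor : ∀ j → Q.θ (toSer (factorˢ j)) ≋ᑫ (1-b ∙ᑫ (logDerivTerm j *ᑫ toSer (factorˢ j)))
  θ-factor j = begin
    Q.θ (toSer (factorˢ j))                                    ≈⟨ Q.θ-cong (factor-dilate j) ⟩
    Q.θ (Q.dilate j a)                                         ≈⟨ Q.θ-dilate j a ⟩
    [j+1] ∙ᑫ Q.dilate j (Q.θ a)                                    ≈⟨ Q.∙-cong RB.refl (Q.dilate-cong j θ-binomialSeries) ⟩
    [j+1] ∙ᑫ Q.dilate j (1-b ∙ᑫ (q/[1-q] *ᑫ a))                   ≈⟨ Q.∙-cong RB.refl (Q.dilate-∙ j 1-b (q/[1-q] *ᑫ a)) ⟩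
    [j+1] ∙ᑫ (1-b ∙ᑫ Q.dilate j (q/[1-q] *ᑫ a))                   ≈⟨ Q.∙-cong RB.refl (Q.∙-cong RB.refl (Q.dilate-*ₛ j q/[1-q] a)) ⟩
    [j+1] ∙ᑫ (1-b ∙ᑫ (Q.dilate j q/[1-q] *ᑫ Q.dilate j a))        ≈⟨ ∙ᑫ-swap _ _ _ ⟩
    1-b ∙ᑫ ([j+1] ∙ᑫ (Q.dilate j q/[1-q] *ᑫ Q.dilate j a))        ≈⟨ Q.∙-cong RB.refl (Q.≋-sym (Q.∙-*ₛ [j+1] (Q.dilate j q/[1-q]) (Q.dilate j a))) ⟩
    1-b ∙ᑫ (logDerivTerm j *ᑫ Q.dilate j a)                    ≈⟨ Q.∙-cong RB.refl (Q.*ₛ-cong Q.≋-refl (Q.≋-sym (factor-dilate j))) ⟩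
    1-b ∙ᑫ (logDerivTerm j *ᑫ toSer (factorˢ j)) ∎
    where
    open import Relation.Binary.Reasoning.Setoid RQ.setoid
    a = binomialSeries
    [j+1] = Q.fromℕ (suc j)

  Λ : ℕ → Q.Ser
  Λ zero = Q.0ₛ
  Λ (suc N) = Λ N +ᑫ logDerivTerm N

  θ-product : ∀ N → Q.θ (toSer (prodTo N)) ≋ᑫ (1-b ∙ᑫ (Λ N *ᑫ toSer (prodTo N)))
  θ-product zero = Q.≋-trans (Q.θ-cong toSer-oneˢ) (Q.≋-trans Q.θ-1ₛ (Q.≋-sym
    (Q.≋-trans (Q.∙-cong RB.refl (Q.0ₛ*ₛ _)) (λ n → RB.zeroʳ 1-b))))
  θ-product (suc N) = begin
    Q.θ (toSer (prodTo N *ˢ factorˢ N))                  ≈⟨ Q.θ-cong (toSer-* (prodTo N) (factorˢ N)) ⟩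
    Q.θ (A *ᑫ F)                                          ≈⟨ Q.θ-leibniz A F ⟩
    Q.θ A *ᑫ F +ᑫ A *ᑫ Q.θ F                             ≈⟨ Q.+ₛ-cong (Q.*ₛ-cong (Q.≋-trans (θ-product N) (∙-as-const _)) Q.≋-refl)
                                                                     (Q.*ₛ-cong Q.≋-refl (Q.≋-trans (θ-factor N) (∙-as-const _))) ⟩
    (c *ᑫ (Λ N *ᑫ A)) *ᑫ F +ᑫ A *ᑫ (c *ᑫ (L *ᑫ F))      ≈⟨ regroup c (Λ N) L A F ⟩
    c *ᑫ ((Λ N +ᑫ L) *ᑫ (A *ᑫ F))                        ≈⟨ Q.≋-sym (∙-as-const _) ⟩
    1-b ∙ᑫ (Λ (suc N) *ᑫ (A *ᑫ F))                       ≈⟨ Q.∙-cong RB.refl (Q.*ₛ-cong Q.≋-refl (Q.≋-sym (toSer-* (prodTo N) (factorˢ N)))) ⟩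
    1-b ∙ᑫ (Λ (suc N) *ᑫ toSer (prodTo N *ˢ factorˢ N)) ∎
    where
    open import Relation.Binary.Reasoning.Setoid RQ.setoid
    open import Algebra.Solver.Ring.NaturalCoefficients.Default RQ.commutativeSemiring
    A = toSer (prodTo N)
    F = toSer (factorˢ N)
    L = logDerivTerm N
    c = Q.const 1-b
    ∙-as-const : ∀ f → (1-b ∙ᑫ f) ≋ᑫ (c *ᑫ f)
    ∙-as-const f = Q.≋-sym (Q.const*ₛ 1-b f)
    regroup : ∀ c x y a f → ((c *ᑫ (x *ᑫ a)) *ᑫ f) +ᑫ (a *ᑫ (c *ᑫ (y *ᑫ f))) ≋ᑫ (c *ᑫ ((x +ᑫ y) *ᑫ (a *ᑫ f)))
    regroup = solve 5 (λ c x y a f → (((c :* (x :* a)) :* f) :+ (a :* (c :* (y :* f)))) := (c :* ((x :+ y) :* (a :* f)))) RQ.refl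

  -- Factors with index j > i do not affect the coefficient of q^i, so the
  -- coefficient of q^m of F_N does not depend on N ≥ m.
  factor-constant-term : ∀ N → toSer (factorˢ N) 0 ≋ᵇ B.1ₛ
  factor-constant-term N zero = refl
  factor-constant-term N (suc e) = refl

  factor-vanishes-below : ∀ N i → 0 < i → i ≤ N → toSer (factorˢ N) i ≋ᵇ B.0ₛ
  factor-vanishes-below N i 0<i i≤N =
    ≡⇒≋ᵇ (cong coeff (factorˢ-∤ N i λ d → ℕP.<⇒≱ (s≤s i≤N) (ℕD.∣⇒≤ {{ℕ.>-nonZero 0<i}} d)))

  product-stable : ∀ N m → m ≤ N → toSer (prodTo N) m ≋ᵇ toSer (prodTo m) m
  product-stable zero zero z≤n = B.≋-refl
  product-stable (suc N) m m≤sN with ℕP.m≤n⇒m<n∨m≡n m≤sN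
  ... | inj₂ refl = B.≋-refl
  ... | inj₁ (s≤s m≤N) = B.≋-trans (toSer-* (prodTo N) (factorˢ N) m)
     (B.≋-trans (Q.*ₛ-unit-below (toSer (prodTo N)) (toSer (factorˢ N)) m (factor-constant-term N)
        (λ i 0<i i≤m → factor-vanishes-below N i 0<i (ℕP.≤-trans i≤m m≤N))) (product-stable N m m≤N))


-- Comparing coefficients of q^n in θ F_N = (1-b) Λ_N F_N (for N ≥ n) gives
-- Euler's recurrence   n P_n = (1-b) Σ_{i≤n} σ(i) P_(n-i),   where P_n is the
-- q^n-coefficient of the product and σ the divisor sum; multiplying by
-- (n-1)! turns it into a recurrence for p_n = n! P_n.
module Recurrence where

  open import Defs
  open RationalEmbedding
  open ProductSeries
  open import Data.Nat as ℕ using (ℕ; zero; suc; _∸_; _≤_; s≤s; _!; _+_; _*_)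
  import Data.Nat.Properties as ℕP
  import Data.Nat.DivMod as ℕM
  open import Data.Nat.Divisibility as ℕD using (_∣_; _∣?_)
  open import Data.Integer using (+_)
  import Data.Integer.Properties as ℤP
  open import Data.Rational as ℚ using (ℚ; 0ℚ)
  import Data.Rational.Properties as ℚP
  open import Relation.Binary.PropositionalEquality
  open import Relation.Nullary using (yes; no; ¬_; Dec)
  open import Data.Empty using (⊥-elim)
  open import Data.Nat.Tactic.RingSolver using (solve-∀)

  open B using () renaming (_≋_ to _≋ᵇ_; _+ₛ_ to _+ᵇ_; _*ₛ_ to _*ᵇ_; _∙_ to _∙ᵇ_)
  open Q using () renaming (_*ₛ_ to _*ᑫ_)

  ιℕ : ℕ → ℚ
  ιℕ n = ι (+ n)

  ιℕ-* : ∀ m n → ιℕ (m * n) ≡ ιℕ m ℚ.* ιℕ n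
  ιℕ-* m n = trans (cong ι (ℤP.pos-* m n)) (ι-* (+ m) (+ n))

  const-+ : ∀ x y → (B.const x +ᵇ B.const y) ≋ᵇ B.const (x ℚ.+ y)
  const-+ x y zero = refl
  const-+ x y (suc e) = ℚP.+-identityˡ 0ℚ

  const-* : ∀ x y → (B.const x *ᵇ B.const y) ≋ᵇ B.const (x ℚ.* y)
  const-* x y = B.≋-trans (B.const*ₛ x (B.const y)) (B.∙-const x y)

  -- 1 if i > 0, the coefficients of q/(1-q)
  positive : ℕ → ℕ
  positive zero = 0
  positive (suc _) = 1

  -- 1 if i is a positive multiple of j+1, the coefficients of q^(j+1)/(1-q^(j+1))
  positiveMultiple : ℕ → ℕ → ℕ
  positiveMultiple j i with suc j ∣? i
  ... | yes _ = positive (i ℕ./ suc j)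
  ... | no _ = 0

  positiveMultiple-∣ : ∀ j i → suc j ∣ i → positiveMultiple j i ≡ positive (i ℕ./ suc j)
  positiveMultiple-∣ j i d with suc j ∣? i
  ... | yes _ = refl
  ... | no ¬d = ⊥-elim (¬d d)

  positiveMultiple-∤ : ∀ j i → ¬ (suc j ∣ i) → positiveMultiple j i ≡ 0
  positiveMultiple-∤ j i ¬d with suc j ∣? i
  ... | yes d = ⊥-elim (¬d d)
  ... | no _ = refl

  positiveMultiple-0 : ∀ j → positiveMultiple j 0 ≡ 0
  positiveMultiple-0 j = trans (positiveMultiple-∣ j 0 (ℕD.divides 0 refl)) (cong positive (ℕM.0/n≡0 (suc j)))

  -- divisorSum N i = sum of the divisors d ≤ N of i (and 0 for i = 0),
  -- the coefficient of q^i in Λ_N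
  divisorSum : ℕ → ℕ → ℕ
  divisorSum zero i = 0
  divisorSum (suc N) i = divisorSum N i + suc N * positiveMultiple N i

  divisorSum-0 : ∀ N → divisorSum N 0 ≡ 0
  divisorSum-0 zero = refl
  divisorSum-0 (suc N) = trans (cong₂ _+_ (divisorSum-0 N) (cong (suc N *_) (positiveMultiple-0 N))) (ℕP.*-zeroʳ (suc N))

  q/[1-q]-const : ∀ m → q/[1-q] m ≋ᵇ B.const (ιℕ (positive m))
  q/[1-q]-const zero zero = refl
  q/[1-q]-const zero (suc e) = refl
  q/[1-q]-const (suc m) zero = refl
  q/[1-q]-const (suc m) (suc e) = refl

  dilate-q/[1-q] : ∀ j i → Q.dilate j q/[1-q] i ≋ᵇ B.const (ιℕ (positiveMultiple j i))
  dilate-q/[1-q] j i = by-cases (suc j ∣? i)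
    where
    by-cases : Dec (suc j ∣ i) → Q.dilate j q/[1-q] i ≋ᵇ B.const (ιℕ (positiveMultiple j i))
    by-cases (yes d) = B.≋-trans (≡⇒≋ᵇ (Q.dilate-∣ j q/[1-q] i d))
       (B.≋-trans (q/[1-q]-const (i ℕ./ suc j)) (≡⇒≋ᵇ (cong (λ t → B.const (ιℕ t)) (sym (positiveMultiple-∣ j i d)))))
    by-cases (no ¬d) = B.≋-trans (≡⇒≋ᵇ (Q.dilate-∤ j q/[1-q] i ¬d))
       (B.≋-trans (q/[1-q]-const 0) (≡⇒≋ᵇ (cong (λ t → B.const (ιℕ t)) (sym (positiveMultiple-∤ j i ¬d)))))

  Λ-divisorSum : ∀ N i → Λ N i ≋ᵇ B.const (ιℕ (divisorSum N i))
  Λ-divisorSum zero i zero = refl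
  Λ-divisorSum zero i (suc e) = refl
  Λ-divisorSum (suc N) i = B.≋-trans (B.+ₛ-cong (Λ-divisorSum N i)
       (B.*ₛ-cong (fromℕ-const (suc N)) (dilate-q/[1-q] N i)))
    (B.≋-trans (B.+ₛ-cong {f = B.const (ιℕ σ)} B.≋-refl (const-* (ιℕ (suc N)) (ιℕ (positiveMultiple N i))))
    (B.≋-trans (const-+ (ιℕ σ) (ιℕ (suc N) ℚ.* ιℕ (positiveMultiple N i)))
    (≡⇒≋ᵇ (cong B.const (sym (trans (ι-+ (+ σ) (+ (suc N * positiveMultiple N i)))
                                    (cong (ιℕ σ ℚ.+_) (ιℕ-* (suc N) (positiveMultiple N i)))))))))
    where σ = divisorSum N i

  productCoeff : ℕ → B.Ser
  productCoeff m = toSer (prodTo m) m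

  coeff-p : ∀ m → coeff (p m) ≋ᵇ (ιℕ (m !) ∙ᵇ productCoeff m)
  coeff-p m = coeff-scaleᴾ _ (prodCoeff m)

  falling : ℕ → ℕ → ℕ
  falling x zero = 1
  falling x (suc r) = x * falling (x ∸ 1) r

  factorial-falling : ∀ x r → r ≤ x → x ! ≡ falling x r * (x ∸ r) !
  factorial-falling x zero _ = sym (ℕP.*-identityˡ _)
  factorial-falling (suc y) (suc r) (s≤s r≤y) =
    trans (cong (suc y *_) (factorial-falling y r r≤y)) (sym (ℕP.*-assoc (suc y) (falling y r) ((y ∸ r) !)))

  weight-split : ∀ n' i N → i ≤ suc n' →
    ιℕ (n' !) ℚ.* ιℕ (divisorSum N i) ≡ ιℕ (divisorSum N i * falling n' (i ∸ 1)) ℚ.* ιℕ ((suc n' ∸ i) !)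
  weight-split n' i N i≤n = trans (sym (ιℕ-* (n' !) (divisorSum N i)))
    (trans (cong ιℕ (in-ℕ i i≤n)) (ιℕ-* (divisorSum N i * falling n' (i ∸ 1)) ((suc n' ∸ i) !)))
    where
    in-ℕ : ∀ i → i ≤ suc n' → n' ! * divisorSum N i ≡ (divisorSum N i * falling n' (i ∸ 1)) * (suc n' ∸ i) !
    in-ℕ zero _ rewrite divisorSum-0 N = ℕP.*-zeroʳ (n' !)
    in-ℕ (suc r) (s≤s r≤n') rewrite factorial-falling n' r r≤n' = rearrange (falling n' r) ((n' ∸ r) !) (divisorSum N (suc r))
      where
      rearrange : ∀ a b c → a * b * c ≡ c * a * b
      rearrange = solve-∀

  -- The i-th summand of the recurrence for p_n.  (Any N ≥ n would do in
  -- place of n + 5; this choice makes divisorSum N i = σ(i) for i ≤ 5.)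
  recTerm : ℕ → ℕ → B.Ser
  recTerm n i = ιℕ (divisorSum (n + 5) i * falling (n ∸ 1) (i ∸ 1)) ∙ᵇ coeff (p (n ∸ i))

  p-recurrence : ∀ n' → coeff (p (suc n')) ≋ᵇ (1-b *ᵇ Q.finSum (recTerm (suc n')) (suc n'))
  p-recurrence n' = begin
    coeff (p n)                          ≈⟨ coeff-p n ⟩
    ιℕ (n !) ∙ᵇ productCoeff n           ≈⟨ B.∙-cong {a = ιℕ (n !)} (trans (ιℕ-* n (n' !)) (ℚP.*-comm (ιℕ n) x)) B.≋-refl ⟩
    (x ℚ.* ιℕ n) ∙ᵇ productCoeff n       ≈⟨ B.≋-sym (∙ᵇ-assoc x (ιℕ n) (productCoeff n)) ⟩
    x ∙ᵇ (ιℕ n ∙ᵇ productCoeff n)        ≈⟨ ∙ᵇ-congˡ x (B.≋-sym (B.≋-trans (fromℕ-*ᵇ n (F n))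
                                                    (∙ᵇ-congˡ (ιℕ n) (product-stable N n (ℕP.m≤m+n n 5))))) ⟩
    x ∙ᵇ Q.θ F n                         ≈⟨ ∙ᵇ-congˡ x (θ-product N n) ⟩
    x ∙ᵇ (1-b *ᵇ (Λ N *ᑫ F) n)           ≈⟨ ∙ᵇ-congˡ x (B.*ₛ-cong {f = 1-b} B.≋-refl (Q.*ₛ-as-finSum (Λ N) F n)) ⟩
    x ∙ᵇ (1-b *ᵇ S)                      ≈⟨ B.≋-sym (B.*ₛ-∙ x 1-b S) ⟩
    1-b *ᵇ (x ∙ᵇ S)                      ≈⟨ B.*ₛ-cong {f = 1-b} B.≋-refl (B.≋-trans (B.≋-sym (B.const*ₛ x S))
                                                                                   (Q.finSum-* (B.const x) _ n)) ⟩
    1-b *ᵇ Q.finSum (λ i → B.const x *ᵇ (Λ N i *ᵇ F (n ∸ i))) n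
                                         ≈⟨ B.*ₛ-cong {f = 1-b} B.≋-refl (Q.finSum-cong n summand) ⟩
    1-b *ᵇ Q.finSum (recTerm n) n        ∎
    where
    open import Relation.Binary.Reasoning.Setoid RB.setoid
    n = suc n'
    N = n + 5
    x = ιℕ (n' !)
    F = toSer (prodTo N)
    S = Q.finSum (λ i → Λ N i *ᵇ F (n ∸ i)) n
    summand : ∀ i → i ≤ n → (B.const x *ᵇ (Λ N i *ᵇ F (n ∸ i))) ≋ᵇ recTerm n i
    summand i i≤n = begin
      B.const x *ᵇ (Λ N i *ᵇ F (n ∸ i))
        ≈⟨ B.*ₛ-cong {f = B.const x} B.≋-refl (B.*ₛ-cong (Λ-divisorSum N i)
             (product-stable N (n ∸ i) (ℕP.≤-trans (ℕP.m∸n≤m n i) (ℕP.m≤m+n n 5)))) ⟩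
      B.const x *ᵇ (B.const σ *ᵇ productCoeff (n ∸ i))
        ≈⟨ B.≋-trans (B.const*ₛ x _) (∙ᵇ-congˡ x (B.const*ₛ σ _)) ⟩
      x ∙ᵇ (σ ∙ᵇ productCoeff (n ∸ i))
        ≈⟨ B.≋-trans (∙ᵇ-assoc x σ _) (B.∙-cong {f = productCoeff (n ∸ i)} (weight-split n' i N i≤n) B.≋-refl) ⟩
      (w ℚ.* ιℕ ((n ∸ i) !)) ∙ᵇ productCoeff (n ∸ i)
        ≈⟨ B.≋-trans (B.≋-sym (∙ᵇ-assoc w _ _)) (∙ᵇ-congˡ w (B.≋-sym (coeff-p (n ∸ i)))) ⟩
      recTerm n i ∎
      where
      σ = ιℕ (divisorSum N i)
      w = ιℕ (divisorSum N i * falling n' (i ∸ 1))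


-- Congruence modulo d on ℤ, packaged as a commutative ring structure on ℤ
-- with a coarser equality (this is ℤ/dℤ as a setoid).
module IntegersModulo (d : Data.Nat.ℕ) where

  open import Data.Integer as ℤ using (ℤ; +_; _+_; _*_; -_; 0ℤ; 1ℤ)
  import Data.Integer.Properties as ℤP
  open import Data.Product using (_,_)
  open import Relation.Binary.PropositionalEquality
  open import Data.Integer.Tactic.RingSolver using (solve-∀)
  open import Data.Nat.Divisibility using (_∣_; divides)
  open import Algebra using (CommutativeRing; IsCommutativeRing)
  open import Level using (0ℓ)

  infix 4 _≈ₘ_
  record _≈ₘ_ (a b : ℤ) : Set where
    constructor _,_
    field
      quotient : ℤ
      equation : a ≡ b + quotient * + d

  ≡⇒≈ₘ : ∀ {a b} → a ≡ b → a ≈ₘ b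
  ≡⇒≈ₘ {a} refl = 0ℤ , sym (ℤP.+-identityʳ a)

  ≈ₘ-refl : ∀ {a} → a ≈ₘ a
  ≈ₘ-refl = ≡⇒≈ₘ refl

  ≈ₘ-sym : ∀ {a b} → a ≈ₘ b → b ≈ₘ a
  ≈ₘ-sym {a} {b} (q , refl) = - q , l b q (+ d)
    where l : ∀ b q m → b ≡ b + q * m + - q * m
          l = solve-∀

  ≈ₘ-trans : ∀ {a b c} → a ≈ₘ b → b ≈ₘ c → a ≈ₘ c
  ≈ₘ-trans {a} {b} {c} (q , refl) (r , refl) = q + r , l c q r (+ d)
    where l : ∀ c q r m → c + r * m + q * m ≡ c + (q + r) * m
          l = solve-∀

  +-congₘ : ∀ {a a' b b'} → a ≈ₘ a' → b ≈ₘ b' → a + b ≈ₘ a' + b'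
  +-congₘ {a' = a'} {b' = b'} (q , refl) (r , refl) = q + r , l a' b' q r (+ d)
    where l : ∀ a b q r m → a + q * m + (b + r * m) ≡ a + b + (q + r) * m
          l = solve-∀

  *-congₘ : ∀ {a a' b b'} → a ≈ₘ a' → b ≈ₘ b' → a * b ≈ₘ a' * b'
  *-congₘ {a' = a'} {b' = b'} (q , refl) (r , refl) = q * (b' + r * + d) + a' * r , l a' b' q r (+ d)
    where l : ∀ a b q r m → (a + q * m) * (b + r * m) ≡ a * b + (q * (b + r * m) + a * r) * m
          l = solve-∀

  neg-congₘ : ∀ {a a'} → a ≈ₘ a' → - a ≈ₘ - a'
  neg-congₘ {a' = a'} (q , refl) = - q , l a' q (+ d)
    where l : ∀ a q m → - (a + q * m) ≡ - a + - q * m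
          l = solve-∀

  ∣⇒≈ₘ0 : ∀ x → d ∣ x → + x ≈ₘ + 0
  ∣⇒≈ₘ0 x (divides q refl) = + q , trans (ℤP.pos-* q d) (sym (ℤP.+-identityˡ _))

  ≈ₘ0⇒∣ : ∀ x → + x ≈ₘ + 0 → d ∣ x
  ≈ₘ0⇒∣ x (q , eq) = divides ℤ.∣ q ∣ (trans (cong ℤ.∣_∣ (trans eq (ℤP.+-identityˡ (q * + d)))) (ℤP.abs-* q (+ d)))

  ℤmod-isCommutativeRing : IsCommutativeRing _≈ₘ_ _+_ _*_ -_ 0ℤ 1ℤ
  ℤmod-isCommutativeRing = record
    { isRing = record
      { +-isAbelianGroup = record
        { isGroup = record
          { isMonoid = record
            { isSemigroup = record
              { isMagma = record
                { isEquivalence = record { refl = ≈ₘ-refl ; sym = ≈ₘ-sym ; trans = ≈ₘ-trans }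
                ; ∙-cong = +-congₘ }
              ; assoc = λ x y z → ≡⇒≈ₘ (ℤP.+-assoc x y z) }
            ; identity = (λ x → ≡⇒≈ₘ (ℤP.+-identityˡ x)) , (λ x → ≡⇒≈ₘ (ℤP.+-identityʳ x)) }
          ; inverse = (λ x → ≡⇒≈ₘ (ℤP.+-inverseˡ x)) , (λ x → ≡⇒≈ₘ (ℤP.+-inverseʳ x))
          ; ⁻¹-cong = neg-congₘ }
        ; comm = λ x y → ≡⇒≈ₘ (ℤP.+-comm x y) }
      ; *-cong = *-congₘ
      ; *-assoc = λ x y z → ≡⇒≈ₘ (ℤP.*-assoc x y z)
      ; *-identity = (λ x → ≡⇒≈ₘ (ℤP.*-identityˡ x)) , (λ x → ≡⇒≈ₘ (ℤP.*-identityʳ x))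
      ; distrib = (λ x y z → ≡⇒≈ₘ (ℤP.*-distribˡ-+ x y z)) , (λ x y z → ≡⇒≈ₘ (ℤP.*-distribʳ-+ x y z)) }
    ; *-comm = λ x y → ≡⇒≈ₘ (ℤP.*-comm x y) }

  ℤmod : CommutativeRing 0ℓ 0ℓ
  ℤmod = record { isCommutativeRing = ℤmod-isCommutativeRing }


-- Reduction modulo 5.  B₅ = (ℤ/5)[[b]] receives the integer polynomials
-- (lists over ℤ), and x ⇝ y says that the rational x is an integer
-- congruent to y mod 5; this relation is compatible with + and ·.
module Reduction where

  open import Data.Nat using (zero; suc; _≤_; z≤n)
  import Data.Nat.Properties as ℕP
  open import Data.Integer as ℤ using (ℤ; +_; 0ℤ)
  import Data.Integer.Properties as ℤP
  open import Data.Rational as ℚ using (ℚ)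
  import Data.Rational.Properties as ℚP
  open import Data.List using (List; []; _∷_)
  open import Relation.Binary.PropositionalEquality
  open import Algebra using (CommutativeRing)
  open IntegersModulo 5
  open RationalEmbedding
  open ProductSeries using (module B; module Q)

  module B₅ = PowerSeries ℤmod
  module Q₅ = PowerSeries B₅.seriesRing
  module RB₅ = CommutativeRing B₅.seriesRing

  open B using () renaming (_≋_ to _≋ᵇ_; _+ₛ_ to _+ᵇ_; _*ₛ_ to _*ᵇ_; _∙_ to _∙ᵇ_)
  open B₅ using () renaming (_≋_ to _≋₅_; _+ₛ_ to _+₅_; _*ₛ_ to _*₅_; _∙_ to _∙₅_)

  ℤPoly : Set
  ℤPoly = List ℤ

  infixl 6 _+ₗ_
  infixl 7 _*ₗ_

  _+ₗ_ : ℤPoly → ℤPoly → ℤPoly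
  [] +ₗ q = q
  (a ∷ p) +ₗ [] = a ∷ p
  (a ∷ p) +ₗ (c ∷ q) = (a ℤ.+ c) ∷ (p +ₗ q)

  scaleₗ : ℤ → ℤPoly → ℤPoly
  scaleₗ c [] = []
  scaleₗ c (a ∷ p) = (c ℤ.* a) ∷ scaleₗ c p

  _*ₗ_ : ℤPoly → ℤPoly → ℤPoly
  [] *ₗ q = []
  (a ∷ p) *ₗ q = scaleₗ a q +ₗ (0ℤ ∷ (p *ₗ q))

  coeffₗ : ℤPoly → B₅.Ser
  coeffₗ [] i = 0ℤ
  coeffₗ (a ∷ p) zero = a
  coeffₗ (a ∷ p) (suc i) = coeffₗ p i

  coeffₗ-+ : ∀ p q → coeffₗ (p +ₗ q) ≋₅ (coeffₗ p +₅ coeffₗ q)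
  coeffₗ-+ [] q n = ≡⇒≈ₘ (sym (ℤP.+-identityˡ _))
  coeffₗ-+ (a ∷ p) [] n = ≡⇒≈ₘ (sym (ℤP.+-identityʳ _))
  coeffₗ-+ (a ∷ p) (b ∷ q) zero = ≈ₘ-refl
  coeffₗ-+ (a ∷ p) (b ∷ q) (suc n) = coeffₗ-+ p q n

  coeffₗ-scale : ∀ c p → coeffₗ (scaleₗ c p) ≋₅ (c ∙₅ coeffₗ p)
  coeffₗ-scale c [] n = ≡⇒≈ₘ (sym (ℤP.*-zeroʳ c))
  coeffₗ-scale c (a ∷ p) zero = ≈ₘ-refl
  coeffₗ-scale c (a ∷ p) (suc n) = coeffₗ-scale c p n

  coeffₗ-* : ∀ p q → coeffₗ (p *ₗ q) ≋₅ (coeffₗ p *₅ coeffₗ q)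
  coeffₗ-* [] q n = B₅.≋-sym (B₅.0ₛ*ₛ (coeffₗ q)) n
  coeffₗ-* (a ∷ p) q zero = ≈ₘ-trans (coeffₗ-+ (scaleₗ a q) (0ℤ ∷ (p *ₗ q)) 0)
    (≈ₘ-trans (≡⇒≈ₘ (ℤP.+-identityʳ _)) (coeffₗ-scale a q 0))
  coeffₗ-* (a ∷ p) q (suc n) = ≈ₘ-trans (coeffₗ-+ (scaleₗ a q) (0ℤ ∷ (p *ₗ q)) (suc n))
    (+-congₘ (coeffₗ-scale a q (suc n)) (coeffₗ-* p q n))

  infix 4 _⇝_ _⇝ˢ_
  record _⇝_ (x : ℚ) (y : ℤ) : Set where
    constructor reduces
    field
      integer   : ℤ
      embeds    : x ≡ ι integer
      congruent : integer ≈ₘ y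

  _⇝ˢ_ : B.Ser → B₅.Ser → Set
  X ⇝ˢ Y = ∀ e → X e ⇝ Y e

  ⇝-+ : ∀ {x x' y y'} → x ⇝ y → x' ⇝ y' → (x ℚ.+ x') ⇝ (y ℤ.+ y')
  ⇝-+ (reduces z xz zy) (reduces z' xz' zy') =
    reduces (z ℤ.+ z') (trans (cong₂ ℚ._+_ xz xz') (sym (ι-+ z z'))) (+-congₘ zy zy')

  ⇝-* : ∀ {x x' y y'} → x ⇝ y → x' ⇝ y' → (x ℚ.* x') ⇝ (y ℤ.* y')
  ⇝-* (reduces z xz zy) (reduces z' xz' zy') =
    reduces (z ℤ.* z') (trans (cong₂ ℚ._*_ xz xz') (sym (ι-* z z'))) (*-congₘ zy zy')

  ⇝ˢ-resp : ∀ {X X' Y Y'} → X ≋ᵇ X' → Y ≋₅ Y' → X ⇝ˢ Y → X' ⇝ˢ Y'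
  ⇝ˢ-resp p q r e = reduces (integer (r e)) (trans (sym (p e)) (embeds (r e))) (≈ₘ-trans (congruent (r e)) (q e))
    where open _⇝_

  ⇝ˢ-+ : ∀ {X X' Y Y'} → X ⇝ˢ Y → X' ⇝ˢ Y' → (X +ᵇ X') ⇝ˢ (Y +₅ Y')
  ⇝ˢ-+ r r' e = ⇝-+ (r e) (r' e)

  ⇝ˢ-* : ∀ {X X' Y Y'} → X ⇝ˢ Y → X' ⇝ˢ Y' → (X *ᵇ X') ⇝ˢ (Y *₅ Y')
  ⇝ˢ-* r r' zero = ⇝-* (r 0) (r' 0)
  ⇝ˢ-* r r' (suc e) = ⇝-+ (⇝-* (r 0) (r' (suc e))) (⇝ˢ-* (λ i → r (suc i)) r' e)

  ⇝ˢ-scale : ∀ {X Y} w → X ⇝ˢ Y → (ι w ∙ᵇ X) ⇝ˢ (w ∙₅ Y)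
  ⇝ˢ-scale w r e = ⇝-* (reduces w refl ≈ₘ-refl) (r e)

  ⇝ˢ-zero-scale : ∀ X Y → (ι (+ 0) ∙ᵇ X) ⇝ˢ ((+ 0) ∙₅ Y)
  ⇝ˢ-zero-scale X Y e = reduces (+ 0) (ℚP.*-zeroˡ (X e)) (≡⇒≈ₘ (sym (ℤP.*-zeroˡ (Y e))))

  ⇝ˢ-finSum : ∀ {h h'} n → (∀ i → i ≤ n → h i ⇝ˢ h' i) → Q.finSum h n ⇝ˢ Q₅.finSum h' n
  ⇝ˢ-finSum zero r = r 0 z≤n
  ⇝ˢ-finSum (suc n) r = ⇝ˢ-+ (⇝ˢ-finSum n (λ i i≤n → r i (ℕP.m≤n⇒m≤1+n i≤n))) (r (suc n) ℕP.≤-refl)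


-- An explicit model of p_n modulo 5.  Define integer polynomials W_n by
-- W_0..W_4 explicitly and W_(n+5) = (b - b⁵) W_n.  We show that W satisfies
-- the recurrence of p modulo 5: only the summands i ≤ 5 survive (for i > 5
-- the falling factorial has ≥ 5 consecutive factors), their weights are
-- 5-periodic in n, and the cases n ≤ 9 are checked by computation.
module ModelMod5 where

  open import Data.Nat as ℕ using (ℕ; zero; suc; _∸_; _≤_; _<_; z≤n; s≤s; _+_; _*_)
  import Data.Nat.Properties as ℕP
  import Data.Nat.DivMod as ℕM
  open import Data.Nat.Divisibility as ℕD using (_∣_; divides)
  open import Data.Integer as ℤ using (ℤ; +_; -[1+_])
  import Data.Integer.Properties as ℤP
  import Data.Integer.DivMod as ℤM
  open import Data.List using ([]; _∷_)
  open import Data.Bool using (Bool; true; _∧_; T)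
  import Data.Bool.Properties as BoolP
  open import Data.Product using (_×_; proj₁; proj₂)
  open import Data.Unit using (tt)
  open import Function.Bundles using (Equivalence)
  open import Relation.Binary.PropositionalEquality
  open import Relation.Nullary using (yes; no)
  open IntegersModulo 5
  open Reduction
  open Recurrence using (divisorSum; positiveMultiple; positiveMultiple-0; positiveMultiple-∤; falling)

  open B₅ using () renaming (_≋_ to _≋₅_; _*ₛ_ to _*₅_; _∙_ to _∙₅_)

  b-b⁵ : ℤPoly
  b-b⁵ = + 0 ∷ + 1 ∷ + 0 ∷ + 0 ∷ + 0 ∷ -[1+ 0 ] ∷ []

  1-bₗ : ℤPoly
  1-bₗ = + 1 ∷ -[1+ 0 ] ∷ []

  W : ℕ → ℤPoly
  W 0 = + 1 ∷ []
  W 1 = + 1 ∷ + 4 ∷ []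
  W 2 = + 4 ∷ + 0 ∷ + 1 ∷ []
  W 3 = + 3 ∷ + 1 ∷ + 2 ∷ + 4 ∷ []
  W 4 = + 0 ∷ + 2 ∷ + 4 ∷ + 3 ∷ + 1 ∷ []
  W (suc (suc (suc (suc (suc k))))) = b-b⁵ *ₗ W k

  W-step : ∀ k → W (k + 5) ≡ b-b⁵ *ₗ W k
  W-step k rewrite ℕP.+-comm k 5 = refl

  [b-b⁵] : B₅.Ser
  [b-b⁵] = coeffₗ b-b⁵

  [1-b] : B₅.Ser
  [1-b] = coeffₗ 1-bₗ

  σ : ℕ → ℕ
  σ 1 = 1
  σ 2 = 3
  σ 3 = 4
  σ 4 = 7
  σ 5 = 6
  σ _ = 0

  -- Divisors larger than i do not contribute to divisorSum N i.
  divisorSum-saturates : ∀ t i → i ≤ 5 → divisorSum (5 + t) i ≡ divisorSum 5 i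
  divisorSum-saturates zero i _ = refl
  divisorSum-saturates (suc t) i i≤5 =
    trans (cong₂ _+_ (divisorSum-saturates t i i≤5) (trans (cong (suc (5 + t) *_) (no-multiple i i≤5)) (ℕP.*-zeroʳ (suc (5 + t)))))
          (ℕP.+-identityʳ _)
    where
    no-multiple : ∀ i → i ≤ 5 → positiveMultiple (5 + t) i ≡ 0
    no-multiple zero _ = positiveMultiple-0 (5 + t)
    no-multiple (suc i) si≤5 = positiveMultiple-∤ (5 + t) (suc i) λ d → ℕP.<⇒≱ (s≤s (ℕP.≤-trans si≤5 (ℕP.m≤m+n 5 t))) (ℕD.∣⇒≤ d)

  divisorSum-5 : ∀ i → i ≤ 5 → divisorSum 5 i ≡ σ i
  divisorSum-5 0 _ = refl
  divisorSum-5 1 _ = refl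
  divisorSum-5 2 _ = refl
  divisorSum-5 3 _ = refl
  divisorSum-5 4 _ = refl
  divisorSum-5 5 _ = refl
  divisorSum-5 (suc (suc (suc (suc (suc (suc i)))))) (s≤s (s≤s (s≤s (s≤s (s≤s ())))))

  divisorSum-small : ∀ n i → i ≤ 5 → divisorSum (n + 5) i ≡ σ i
  divisorSum-small n i i≤5 = trans (cong (λ t → divisorSum t i) (ℕP.+-comm n 5)) (trans (divisorSum-saturates n i i≤5) (divisorSum-5 i i≤5))

  factor∣falling : ∀ x r t → t < r → (x ∸ t) ∣ falling x r
  factor∣falling x (suc r) zero _ = ℕD.m∣m*n (falling (x ∸ 1) r)
  factor∣falling x (suc r) (suc t) (s≤s t<r) =
    ℕD.∣n⇒∣m*n x (subst (_∣ falling (x ∸ 1) r) (ℕP.∸-+-assoc x 1 t) (factor∣falling (x ∸ 1) r t t<r))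

  ∣m∸m%n : ∀ m n .{{_ : ℕ.NonZero n}} → n ∣ (m ∸ m ℕ.% n)
  ∣m∸m%n m n = divides (m ℕ./ n) (trans (cong (_∸ m ℕ.% n) (ℕM.m≡m%n+[m/n]*n m n)) (ℕP.m+n∸m≡n (m ℕ.% n) _))

  falling-divisible : ∀ d .{{_ : ℕ.NonZero d}} x r → d ≤ r → d ∣ falling x r
  falling-divisible d x r d≤r =
    ℕD.∣-trans (∣m∸m%n x d) (factor∣falling x r (x ℕ.% d) (ℕP.<-≤-trans (ℕM.m%n<n x d) d≤r))

  falling-periodic : ∀ x r → r ≤ x → + falling (x + 5) r ≈ₘ + falling x r
  falling-periodic x zero _ = ≈ₘ-refl
  falling-periodic (suc x) (suc r) (s≤s r≤x) = ≈ₘ-trans (≡⇒≈ₘ (ℤP.pos-* (suc x + 5) (falling (x + 5) r)))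
     (≈ₘ-trans (*-congₘ {a = + (suc x + 5)} {a' = + suc x} ((+ 1) , refl) (falling-periodic x r r≤x))
               (≡⇒≈ₘ (sym (ℤP.pos-* (suc x) (falling x r)))))

  ≡0mod5? : ℤ → Bool
  ≡0mod5? z = (z ℤ.%ℕ 5) ℕ.≡ᵇ 0

  ≡0mod5?-sound : ∀ z → T (≡0mod5? z) → z ≈ₘ + 0
  ≡0mod5?-sound z t = (z ℤ./ℕ 5) , trans (ℤM.a≡a%ℕn+[a/ℕn]*n z 5)
                                          (cong (λ k → + k ℤ.+ (z ℤ./ℕ 5) ℤ.* + 5) (ℕP.≡ᵇ⇒≡ (z ℤ.%ℕ 5) 0 t))

  difference-≈ₘ : ∀ a b → a ℤ.- b ≈ₘ + 0 → a ≈ₘ b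
  difference-≈ₘ a b p = ≈ₘ-trans (≡⇒≈ₘ (sym cancel)) (≈ₘ-trans (+-congₘ p (≈ₘ-refl {b})) (≡⇒≈ₘ (ℤP.+-identityˡ b)))
    where
    cancel : (a ℤ.- b) ℤ.+ b ≡ a
    cancel = trans (ℤP.+-assoc a (ℤ.- b) b) (trans (cong (λ t → a ℤ.+ t) (ℤP.+-inverseˡ b)) (ℤP.+-identityʳ a))

  congruent? : ℤPoly → ℤPoly → Bool
  congruent? [] [] = true
  congruent? (a ∷ l) [] = ≡0mod5? a ∧ congruent? l []
  congruent? [] (b ∷ l) = ≡0mod5? (+ 0 ℤ.- b) ∧ congruent? [] l
  congruent? (a ∷ l) (b ∷ l') = ≡0mod5? (a ℤ.- b) ∧ congruent? l l'

  T-∧-split : ∀ {x y} → T (x ∧ y) → T x × T y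
  T-∧-split {x} {y} = Equivalence.to (BoolP.T-∧ {x} {y})

  congruent?-sound : ∀ l l' → T (congruent? l l') → coeffₗ l ≋₅ coeffₗ l'
  congruent?-sound [] [] t e = ≈ₘ-refl
  congruent?-sound (a ∷ l) [] t zero = ≡0mod5?-sound a (proj₁ (T-∧-split t))
  congruent?-sound (a ∷ l) [] t (suc e) = congruent?-sound l [] (proj₂ (T-∧-split t)) e
  congruent?-sound [] (b ∷ l) t zero = difference-≈ₘ (+ 0) b (≡0mod5?-sound _ (proj₁ (T-∧-split t)))
  congruent?-sound [] (b ∷ l) t (suc e) = congruent?-sound [] l (proj₂ (T-∧-split t)) e
  congruent?-sound (a ∷ l) (b ∷ l') t zero = difference-≈ₘ a b (≡0mod5?-sound _ (proj₁ (T-∧-split t)))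
  congruent?-sound (a ∷ l) (b ∷ l') t (suc e) = congruent?-sound l l' (proj₂ (T-∧-split t)) e

  sumₗ : (ℕ → ℤPoly) → ℕ → ℤPoly
  sumₗ h zero = h 0
  sumₗ h (suc n) = sumₗ h n +ₗ h (suc n)

  coeffₗ-sumₗ : ∀ h n → coeffₗ (sumₗ h n) ≋₅ Q₅.finSum (λ i → coeffₗ (h i)) n
  coeffₗ-sumₗ h zero = B₅.≋-refl
  coeffₗ-sumₗ h (suc n) = B₅.≋-trans (coeffₗ-+ (sumₗ h n) (h (suc n))) (B₅.+ₛ-cong (coeffₗ-sumₗ h n) B₅.≋-refl)

  modelWeight : ℕ → ℕ → ℤ
  modelWeight n i = + (σ i * falling (n ∸ 1) (i ∸ 1))

  modelTerm : ℕ → ℕ → B₅.Ser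
  modelTerm n i = modelWeight n i ∙₅ coeffₗ (W (n ∸ i))

  ModelRecurrence : ℕ → ℕ → Set
  ModelRecurrence n k = ([1-b] *₅ Q₅.finSum (modelTerm n) k) ≋₅ coeffₗ (W n)

  model-recurrence-by-computation : ∀ n k →
    T (congruent? (1-bₗ *ₗ sumₗ (λ i → scaleₗ (modelWeight n i) (W (n ∸ i))) k) (W n)) → ModelRecurrence n k
  model-recurrence-by-computation n k t = B₅.≋-trans (B₅.≋-sym evaluate) (congruent?-sound (1-bₗ *ₗ sumₗ h k) (W n) t)
    where
    h = λ i → scaleₗ (modelWeight n i) (W (n ∸ i))
    evaluate : coeffₗ (1-bₗ *ₗ sumₗ h k) ≋₅ ([1-b] *₅ Q₅.finSum (modelTerm n) k)
    evaluate = B₅.≋-trans (coeffₗ-* 1-bₗ (sumₗ h k)) (B₅.*ₛ-cong B₅.≋-refl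
      (B₅.≋-trans (coeffₗ-sumₗ h k) (Q₅.finSum-cong k (λ i _ → coeffₗ-scale (modelWeight n i) (W (n ∸ i))))))

  modelTerm-periodic : ∀ m i → 5 ≤ m → i ≤ 5 → modelTerm (m + 5) i ≋₅ ([b-b⁵] *₅ modelTerm m i)
  modelTerm-periodic m i 5≤m i≤5 = B₅.≋-trans (B₅.∙-cong weight (λ e → ≡⇒≈ₘ (cong (λ l → coeffₗ l e) model)))
     (B₅.≋-trans (B₅.∙-cong {a = modelWeight m i} ≈ₘ-refl (coeffₗ-* b-b⁵ (W (m ∸ i))))
     (B₅.≋-sym (B₅.*ₛ-∙ (modelWeight m i) [b-b⁵] (coeffₗ (W (m ∸ i))))))
    where
    i≤m = ℕP.≤-trans i≤5 5≤m
    model : W ((m + 5) ∸ i) ≡ b-b⁵ *ₗ W (m ∸ i)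
    model = trans (cong W (ℕP.+-∸-comm 5 i≤m)) (W-step (m ∸ i))
    weight : modelWeight (m + 5) i ≈ₘ modelWeight m i
    weight = ≈ₘ-trans (≡⇒≈ₘ (trans (cong (λ x → + (σ i * falling x (i ∸ 1))) (ℕP.+-∸-comm 5 (ℕP.≤-trans (s≤s z≤n) 5≤m)))
                                    (ℤP.pos-* (σ i) _)))
             (≈ₘ-trans (*-congₘ (≈ₘ-refl {+ σ i}) (falling-periodic (m ∸ 1) (i ∸ 1) (ℕP.∸-monoˡ-≤ 1 i≤m)))
                       (≡⇒≈ₘ (sym (ℤP.pos-* (σ i) _))))

  model-recurrence-periodic : ∀ m → 5 ≤ m → ModelRecurrence m 5 → ModelRecurrence (m + 5) 5
  model-recurrence-periodic m 5≤m ih = begin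
    [1-b] *₅ Q₅.finSum (modelTerm (m + 5)) 5  ≈⟨ B₅.*ₛ-cong {f = [1-b]} B₅.≋-refl
                                                   (B₅.≋-trans (Q₅.finSum-cong 5 (λ i i≤5 → modelTerm-periodic m i 5≤m i≤5))
                                                               (RB₅.sym (Q₅.finSum-* [b-b⁵] (modelTerm m) 5))) ⟩
    [1-b] *₅ ([b-b⁵] *₅ S)                     ≈⟨ B₅.≋-sym (B₅.*ₛ-assoc [1-b] [b-b⁵] S) ⟩
    ([1-b] *₅ [b-b⁵]) *₅ S                     ≈⟨ B₅.*ₛ-cong (B₅.*ₛ-comm [1-b] [b-b⁵]) B₅.≋-refl ⟩
    ([b-b⁵] *₅ [1-b]) *₅ S                     ≈⟨ B₅.*ₛ-assoc [b-b⁵] [1-b] S ⟩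
    [b-b⁵] *₅ ([1-b] *₅ S)                     ≈⟨ B₅.*ₛ-cong {f = [b-b⁵]} B₅.≋-refl ih ⟩
    [b-b⁵] *₅ coeffₗ (W m)                     ≈⟨ B₅.≋-sym (coeffₗ-* b-b⁵ (W m)) ⟩
    coeffₗ (b-b⁵ *ₗ W m)                       ≈⟨ (λ e → ≡⇒≈ₘ (cong (λ l → coeffₗ l e) (sym (W-step m)))) ⟩
    coeffₗ (W (m + 5))                         ∎
    where
    open import Relation.Binary.Reasoning.Setoid RB₅.setoid
    S = Q₅.finSum (modelTerm m) 5

  model-recurrence-large : ∀ n → 5 ≤ n → ModelRecurrence n 5
  model-recurrence-large 0 ()
  model-recurrence-large 1 (s≤s ())
  model-recurrence-large 2 (s≤s (s≤s ()))
  model-recurrence-large 3 (s≤s (s≤s (s≤s ())))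
  model-recurrence-large 4 (s≤s (s≤s (s≤s (s≤s ()))))
  model-recurrence-large 5 _ = model-recurrence-by-computation 5 5 tt
  model-recurrence-large 6 _ = model-recurrence-by-computation 6 5 tt
  model-recurrence-large 7 _ = model-recurrence-by-computation 7 5 tt
  model-recurrence-large 8 _ = model-recurrence-by-computation 8 5 tt
  model-recurrence-large 9 _ = model-recurrence-by-computation 9 5 tt
  model-recurrence-large (suc (suc (suc (suc (suc (suc (suc (suc (suc (suc k)))))))))) _ =
    subst (λ n → ModelRecurrence n 5) (ℕP.+-comm (5 + k) 5)
      (model-recurrence-periodic (5 + k) (ℕP.m≤m+n 5 k)
        (model-recurrence-large (suc (suc (suc (suc (suc k))))) (ℕP.m≤m+n 5 k)))

  model-recurrence-small : ∀ n' → suc n' ≤ 5 → ModelRecurrence (suc n') (suc n')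
  model-recurrence-small 0 _ = model-recurrence-by-computation 1 1 tt
  model-recurrence-small 1 _ = model-recurrence-by-computation 2 2 tt
  model-recurrence-small 2 _ = model-recurrence-by-computation 3 3 tt
  model-recurrence-small 3 _ = model-recurrence-by-computation 4 4 tt
  model-recurrence-small 4 _ = model-recurrence-by-computation 5 5 tt
  model-recurrence-small (suc (suc (suc (suc (suc _))))) (s≤s (s≤s (s≤s (s≤s (s≤s ())))))

  reducedTerm : ℕ → ℕ → B₅.Ser
  reducedTerm n i = (+ (divisorSum (n + 5) i * falling (n ∸ 1) (i ∸ 1))) ∙₅ coeffₗ (W (n ∸ i))

  reducedTerm-small : ∀ n i → i ≤ 5 → reducedTerm n i ≋₅ modelTerm n i
  reducedTerm-small n i i≤5 = B₅.∙-cong (≡⇒≈ₘ (cong (λ x → + (x * falling (n ∸ 1) (i ∸ 1))) (divisorSum-small n i i≤5))) B₅.≋-refl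

  -- For i > 5 the weight contains the falling factorial of length ≥ 5.
  reducedTerm-large : ∀ n i → 5 < i → reducedTerm n i ≋₅ B₅.0ₛ
  reducedTerm-large n i 5<i e =
    ≈ₘ-trans (*-congₘ weight≈0 (≈ₘ-refl {coeffₗ (W (n ∸ i)) e})) (≡⇒≈ₘ (ℤP.*-zeroˡ (coeffₗ (W (n ∸ i)) e)))
    where
    k = divisorSum (n + 5) i * falling (n ∸ 1) (i ∸ 1)
    5∣k : 5 ∣ k
    5∣k = ℕD.∣n⇒∣m*n (divisorSum (n + 5) i) (falling-divisible 5 (n ∸ 1) (i ∸ 1) (ℕP.∸-monoˡ-≤ 1 5<i))
    weight≈0 : + k ≈ₘ + 0
    weight≈0 = (+ ℕD._∣_.quotient 5∣k) , trans (cong +_ (ℕD._∣_.equality 5∣k))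
                 (trans (ℤP.pos-* (ℕD._∣_.quotient 5∣k) 5) (sym (ℤP.+-identityˡ _)))

  model-recurrence : ∀ n' → ([1-b] *₅ Q₅.finSum (reducedTerm (suc n')) (suc n')) ≋₅ coeffₗ (W (suc n'))
  model-recurrence n' with suc n' ℕP.≤? 5
  ... | yes n≤5 = B₅.≋-trans (B₅.*ₛ-cong {f = [1-b]} B₅.≋-refl
                    (Q₅.finSum-cong (suc n') (λ i i≤n → reducedTerm-small (suc n') i (ℕP.≤-trans i≤n n≤5))))
                  (model-recurrence-small n' n≤5)
  ... | no n≰5 = B₅.≋-trans (B₅.*ₛ-cong {f = [1-b]} B₅.≋-refl
        (B₅.≋-trans (Q₅.finSum-vanishing-tail (reducedTerm (suc n')) 5 (suc n') (ℕP.<⇒≤ 5<n)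
                       (λ i 5<i _ → reducedTerm-large (suc n') i 5<i))
                    (Q₅.finSum-cong 5 (λ i i≤5 → reducedTerm-small (suc n') i i≤5))))
      (model-recurrence-large (suc n') (ℕP.<⇒≤ 5<n))
    where 5<n = ℕP.≰⇒> n≰5


-- The coefficients of W_(5k+4) = (b - b⁵)^k W_4 modulo 5.  Multiplication
-- by b - b⁵ maps coefficient sequences g to g(e-1) - g(e-5); hence the
-- coefficients of b^e, e ≤ k, vanish and the coefficient of b^(k+1+4m) obeys
-- Pascal's rule, giving 2 (-1)^m C(k,m).
module TopCoefficients where

  open import Data.Nat as ℕ using (ℕ; zero; suc; _∸_; _≤_; _<_; z≤n; s≤s; _+_; _*_)
  import Data.Nat.Properties as ℕP
  open import Data.Integer as ℤ using (ℤ; +_; -[1+_])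
  import Data.Integer.Properties as ℤP
  open import Relation.Binary.PropositionalEquality
  open import Relation.Nullary using (yes; no)
  open import Data.Integer.Tactic.RingSolver using (solve-∀)
  import Data.Nat.Tactic.RingSolver as ℕSolver
  open IntegersModulo 5
  open Reduction
  open ModelMod5 using (W; b-b⁵; [b-b⁵]; W-step)

  open B₅ using () renaming (_≋_ to _≋₅_; _+ₛ_ to _+₅_; _*ₛ_ to _*₅_; _∙_ to _∙₅_)

  binom : ℕ → ℕ → ℕ
  binom _ zero = 1
  binom zero (suc m) = 0
  binom (suc k) (suc m) = binom k (suc m) + binom k m

  signℤ : ℕ → ℤ
  signℤ zero = + 1
  signℤ (suc m) = ℤ.- signℤ m

  W[5k+4] : ℕ → B₅.Ser
  W[5k+4] k = coeffₗ (W (5 * k + 4))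

  W[5k+4]-step : ∀ k → W[5k+4] (suc k) ≋₅ ([b-b⁵] *₅ W[5k+4] k)
  W[5k+4]-step k e = ≈ₘ-trans (≡⇒≈ₘ (cong (λ l → coeffₗ l e) (trans (cong W (index k)) (W-step (5 * k + 4)))))
                              (coeffₗ-* b-b⁵ (W (5 * k + 4)) e)
    where
    index : ∀ k → 5 * suc k + 4 ≡ 5 * k + 4 + 5
    index = ℕSolver.solve-∀

  [b-b⁵]-shifts : [b-b⁵] ≋₅ (B₅.shift 1 B₅.1ₛ +₅ (-[1+ 0 ] ∙₅ B₅.shift 5 B₅.1ₛ))
  [b-b⁵]-shifts 0 = ≈ₘ-refl
  [b-b⁵]-shifts 1 = ≈ₘ-refl
  [b-b⁵]-shifts 2 = ≈ₘ-refl
  [b-b⁵]-shifts 3 = ≈ₘ-refl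
  [b-b⁵]-shifts 4 = ≈ₘ-refl
  [b-b⁵]-shifts 5 = ≈ₘ-refl
  [b-b⁵]-shifts (suc (suc (suc (suc (suc (suc t)))))) = ≈ₘ-refl

  [b-b⁵]-* : ∀ g → ([b-b⁵] *₅ g) ≋₅ (B₅.shift 1 g +₅ (-[1+ 0 ] ∙₅ B₅.shift 5 g))
  [b-b⁵]-* g = B₅.≋-trans (B₅.*ₛ-cong [b-b⁵]-shifts (B₅.≋-refl {g}))
    (B₅.≋-trans (B₅.*ₛ-distribʳ _ _ g)
    (B₅.+ₛ-cong (B₅.≋-trans (B₅.shift-*ₛ 1 B₅.1ₛ g) (B₅.shift-cong 1 (B₅.1ₛ*ₛ g)))
       (B₅.≋-trans (B₅.∙-*ₛ -[1+ 0 ] (B₅.shift 5 B₅.1ₛ) g)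
         (B₅.∙-cong (≈ₘ-refl { -[1+ 0 ]}) (B₅.≋-trans (B₅.shift-*ₛ 5 B₅.1ₛ g) (B₅.shift-cong 5 (B₅.1ₛ*ₛ g)))))))

  -- Below b⁵ only the term b g contributes.
  [b-b⁵]-*-low : ∀ g e → e < 4 → ([b-b⁵] *₅ g) (suc e) ≈ₘ g e
  [b-b⁵]-*-low g e e<4 = ≈ₘ-trans ([b-b⁵]-* g (suc e))
    (≈ₘ-trans (+-congₘ (≈ₘ-refl {g e}) (*-congₘ (≈ₘ-refl { -[1+ 0 ]}) (B₅.shift-below 5 g (suc e) (s≤s e<4))))
      (≡⇒≈ₘ (ℤP.+-identityʳ (g e))))

  [b-b⁵]-*-high : ∀ g t → ([b-b⁵] *₅ g) (suc (4 + t)) ≈ₘ g (4 + t) ℤ.- g t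
  [b-b⁵]-*-high g t = ≈ₘ-trans ([b-b⁵]-* g (5 + t))
    (+-congₘ (≈ₘ-refl {g (4 + t)}) (≈ₘ-trans (*-congₘ (≈ₘ-refl { -[1+ 0 ]}) (B₅.shift-above 5 g t)) (≡⇒≈ₘ (ℤP.-1*i≡-i (g t)))))

  [b-b⁵]-*-shift : ∀ g e → (∀ t → 4 + t ≡ e → g t ≈ₘ + 0) → ([b-b⁵] *₅ g) (suc e) ≈ₘ g e
  [b-b⁵]-*-shift g e vanish with e ℕP.<? 4
  ... | yes e<4 = [b-b⁵]-*-low g e e<4
  ... | no e≮4 = subst (λ x → ([b-b⁵] *₅ g) (suc x) ≈ₘ g x) e≡
       (≈ₘ-trans ([b-b⁵]-*-high g t)
         (≈ₘ-trans (+-congₘ (≈ₘ-refl {g (4 + t)}) (neg-congₘ (vanish t e≡))) (≡⇒≈ₘ (ℤP.+-identityʳ _))))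
    where
    t = e ∸ 4
    e≡ : 4 + t ≡ e
    e≡ = ℕP.m+[n∸m]≡n (ℕP.≮⇒≥ e≮4)

  low-coefficients-vanish : ∀ k e → e ≤ k → W[5k+4] k e ≈ₘ + 0
  low-coefficients-vanish zero zero z≤n = ≈ₘ-refl
  low-coefficients-vanish (suc k) zero _ = ≈ₘ-trans (W[5k+4]-step k 0) ([b-b⁵]-* (W[5k+4] k) 0)
  low-coefficients-vanish (suc k) (suc e) (s≤s e≤k) = ≈ₘ-trans (W[5k+4]-step k (suc e))
    (≈ₘ-trans ([b-b⁵]-*-shift (W[5k+4] k) e (λ t eq → low-coefficients-vanish k t
                 (ℕP.≤-trans (ℕP.m≤n+m t 4) (subst (_≤ k) (sym eq) e≤k))))
              (low-coefficients-vanish k e e≤k))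

  top-coefficient : ∀ k m → W[5k+4] k (suc (m * 4 + k)) ≈ₘ + 2 ℤ.* signℤ m ℤ.* + binom k m
  top-coefficient zero zero = ≈ₘ-refl
  top-coefficient zero (suc m) = ≈ₘ-sym (≡⇒≈ₘ (ℤP.*-zeroʳ (+ 2 ℤ.* signℤ (suc m))))
  top-coefficient (suc k) zero = ≈ₘ-trans (W[5k+4]-step k (suc (suc k)))
    (≈ₘ-trans ([b-b⁵]-*-shift (W[5k+4] k) (suc k)
                 (λ t eq → low-coefficients-vanish k t (ℕP.≤-pred (subst (t ℕ.<_) eq (ℕP.m<n+m t (s≤s z≤n))))))
              (top-coefficient k zero))
  top-coefficient (suc k) (suc m) = ≈ₘ-trans (W[5k+4]-step k (suc (4 + (m * 4 + suc k))))
    (≈ₘ-trans ([b-b⁵]-*-high g (m * 4 + suc k))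
    (≈ₘ-trans (+-congₘ (≡⇒≈ₘ (cong (λ x → g (4 + x)) (ℕP.+-suc (m * 4) k)))
                       (neg-congₘ (≡⇒≈ₘ (cong g (ℕP.+-suc (m * 4) k)))))
    (≈ₘ-trans (+-congₘ (top-coefficient k (suc m)) (neg-congₘ (top-coefficient k m)))
    (≡⇒≈ₘ (trans (pascal (signℤ m) (+ binom k (suc m)) (+ binom k m))
                 (cong (λ x → + 2 ℤ.* ℤ.- signℤ m ℤ.* x) (sym (ℤP.pos-+ (binom k (suc m)) (binom k m)))))))))
    where
    g = W[5k+4] k
    pascal : ∀ s x y → + 2 ℤ.* ℤ.- s ℤ.* x ℤ.- + 2 ℤ.* s ℤ.* y ≡ + 2 ℤ.* ℤ.- s ℤ.* (x ℤ.+ y)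
    pascal = solve-∀


module Lucas where

  open import Data.Nat using (ℕ; zero; suc; _≤_; _<_; z≤n; s≤s; _+_; _*_; _%_; _/_; _^_)
  import Data.Nat.Properties as ℕP
  import Data.Nat.DivMod as ℕM
  open import Data.Nat.Divisibility as ℕD using (_∣_; _∣?_; divides)
  open import Data.Nat.Primality using (Prime; prime?; euclidsLemma)
  open import Data.Nat.Induction using (<-rec)
  open import Data.Integer as ℤ using (+_)
  import Data.Integer.Properties as ℤP
  open import Relation.Binary.PropositionalEquality
  open import Relation.Nullary using (yes; no; ¬_)
  open import Relation.Nullary.Decidable using (toWitnessFalse; toWitness)
  open import Data.Unit using (tt)
  open import Data.Sum using (inj₁; inj₂)
  open import Data.Product using (_×_; _,_; proj₁; proj₂)
  open import Data.Empty using (⊥-elim)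
  open import Data.Nat.Tactic.RingSolver using (solve-∀)
  open import Function.Bundles using (_⇔_; mk⇔; Equivalence)
  open Equivalence using (to; from)
  open import Defs using (digit5)
  open IntegersModulo 5
  open TopCoefficients using (binom)

  binom-above : ∀ r s → r < s → binom r s ≡ 0
  binom-above zero (suc s) _ = refl
  binom-above (suc r) (suc s) (s≤s r<s) = cong₂ _+_ (binom-above r (suc s) (ℕP.m≤n⇒m≤1+n r<s)) (binom-above r s r<s)

  pascal-≈ₘ : ∀ {x y x' y'} → + x ≈ₘ x' → + y ≈ₘ y' → + (x + y) ≈ₘ x' ℤ.+ y'
  pascal-≈ₘ {x} {y} p q = ≈ₘ-trans (≡⇒≈ₘ (ℤP.pos-+ x y)) (+-congₘ p q)

  -- C(5, s+1) = C(4, s+1) + C(4, s) ≡ 0 (mod 5) for s < 4.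
  row5-vanishes : ∀ s → s < 4 → ∀ x → + (x * binom 4 (suc s) + x * binom 4 s) ≈ₘ + 0
  row5-vanishes 0 _ x = ∣⇒≈ₘ0 _ (divides x (e x))
    where e : ∀ x → x * 4 + x * 1 ≡ x * 5
          e = solve-∀
  row5-vanishes 1 _ x = ∣⇒≈ₘ0 _ (divides (x * 2) (e x))
    where e : ∀ x → x * 6 + x * 4 ≡ x * 2 * 5
          e = solve-∀
  row5-vanishes 2 _ x = ∣⇒≈ₘ0 _ (divides (x * 2) (e x))
    where e : ∀ x → x * 4 + x * 6 ≡ x * 2 * 5
          e = solve-∀
  row5-vanishes 3 _ x = ∣⇒≈ₘ0 _ (divides x (e x))
    where e : ∀ x → x * 1 + x * 4 ≡ x * 5
          e = solve-∀
  row5-vanishes (suc (suc (suc (suc s)))) (s≤s (s≤s (s≤s (s≤s ()))))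

  -- Lucas: C(r + 5a, s + 5c) ≡ C(a,c) C(r,s) (mod 5) for digits r, s < 5,
  -- by induction on the row r + 5a using Pascal's rule.
  lucas : ∀ a r → r < 5 → ∀ c s → s < 5 → + binom (r + a * 5) (s + c * 5) ≈ₘ + (binom a c * binom r s)
  lucas zero zero _ zero zero _ = ≈ₘ-refl
  lucas zero zero _ c (suc s) _ = ≡⇒≈ₘ (cong +_ (sym (ℕP.*-zeroʳ (binom 0 c))))
  lucas zero zero _ (suc c) zero _ = ≈ₘ-refl
  lucas a (suc r) (s≤s r<4) zero zero _ = ≈ₘ-refl
  lucas a (suc r) (s≤s r<4) (suc c) zero _ =
    ≈ₘ-trans (pascal-≈ₘ (lucas a r r<5 (suc c) 0 (s≤s z≤n)) (lucas a r r<5 c 4 ℕP.≤-refl))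
      (≡⇒≈ₘ (trans (cong (λ t → + (binom a (suc c) * 1) ℤ.+ + (binom a c * t)) (binom-above r 4 r<4))
        (trans (cong (λ t → + (binom a (suc c) * 1) ℤ.+ + t) (ℕP.*-zeroʳ (binom a c))) (ℤP.+-identityʳ _))))
    where r<5 = ℕP.m≤n⇒m≤1+n r<4
  lucas a (suc r) (s≤s r<4) c (suc s) (s≤s s<4) =
    ≈ₘ-trans (pascal-≈ₘ (lucas a r r<5 c (suc s) (s≤s s<4)) (lucas a r r<5 c s (ℕP.m≤n⇒m≤1+n s<4)))
      (≡⇒≈ₘ (trans (sym (ℤP.pos-+ (binom a c * binom r (suc s)) (binom a c * binom r s)))
                   (cong +_ (sym (ℕP.*-distribˡ-+ (binom a c) (binom r (suc s)) (binom r s))))))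
    where r<5 = ℕP.m≤n⇒m≤1+n r<4
  lucas (suc a) zero _ zero zero _ = ≈ₘ-refl
  lucas (suc a) zero _ (suc c) zero _ =
    ≈ₘ-trans (pascal-≈ₘ (lucas a 4 ℕP.≤-refl (suc c) 0 (s≤s z≤n)) (lucas a 4 ℕP.≤-refl c 4 ℕP.≤-refl))
      (≡⇒≈ₘ (trans (sym (ℤP.pos-+ (binom a (suc c) * 1) (binom a c * 1))) (cong +_ (e (binom a (suc c)) (binom a c)))))
    where e : ∀ x y → x * 1 + y * 1 ≡ (x + y) * 1
          e = solve-∀
  lucas (suc a) zero _ c (suc s) (s≤s s<4) =
    ≈ₘ-trans (pascal-≈ₘ (lucas a 4 ℕP.≤-refl c (suc s) (s≤s s<4)) (lucas a 4 ℕP.≤-refl c s (ℕP.m≤n⇒m≤1+n s<4)))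
      (≈ₘ-trans (≡⇒≈ₘ (sym (ℤP.pos-+ (binom a c * binom 4 (suc s)) (binom a c * binom 4 s))))
      (≈ₘ-trans (row5-vanishes s s<4 (binom a c)) (≡⇒≈ₘ (cong +_ (sym (ℕP.*-zeroʳ (binom (suc a) c)))))))

  prime5 : Prime 5
  prime5 = toWitness {a? = prime? 5} tt

  digit-binom-nonzero : ∀ r s → s ≤ r × r < 5 → ¬ 5 ∣ binom r s
  digit-binom-nonzero 0 0 _ = toWitnessFalse {a? = 5 ∣? binom 0 0} tt
  digit-binom-nonzero 1 0 _ = toWitnessFalse {a? = 5 ∣? binom 1 0} tt
  digit-binom-nonzero 1 1 _ = toWitnessFalse {a? = 5 ∣? binom 1 1} tt
  digit-binom-nonzero 2 0 _ = toWitnessFalse {a? = 5 ∣? binom 2 0} tt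
  digit-binom-nonzero 2 1 _ = toWitnessFalse {a? = 5 ∣? binom 2 1} tt
  digit-binom-nonzero 2 2 _ = toWitnessFalse {a? = 5 ∣? binom 2 2} tt
  digit-binom-nonzero 3 0 _ = toWitnessFalse {a? = 5 ∣? binom 3 0} tt
  digit-binom-nonzero 3 1 _ = toWitnessFalse {a? = 5 ∣? binom 3 1} tt
  digit-binom-nonzero 3 2 _ = toWitnessFalse {a? = 5 ∣? binom 3 2} tt
  digit-binom-nonzero 3 3 _ = toWitnessFalse {a? = 5 ∣? binom 3 3} tt
  digit-binom-nonzero 4 0 _ = toWitnessFalse {a? = 5 ∣? binom 4 0} tt
  digit-binom-nonzero 4 1 _ = toWitnessFalse {a? = 5 ∣? binom 4 1} tt
  digit-binom-nonzero 4 2 _ = toWitnessFalse {a? = 5 ∣? binom 4 2} tt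
  digit-binom-nonzero 4 3 _ = toWitnessFalse {a? = 5 ∣? binom 4 3} tt
  digit-binom-nonzero 4 4 _ = toWitnessFalse {a? = 5 ∣? binom 4 4} tt
  digit-binom-nonzero 0 (suc s) (() , _)
  digit-binom-nonzero 1 (suc (suc s)) ((s≤s ()) , _)
  digit-binom-nonzero 2 (suc (suc (suc s))) ((s≤s (s≤s ())) , _)
  digit-binom-nonzero 3 (suc (suc (suc (suc s)))) ((s≤s (s≤s (s≤s ()))) , _)
  digit-binom-nonzero 4 (suc (suc (suc (suc (suc s))))) ((s≤s (s≤s (s≤s (s≤s ())))) , _)
  digit-binom-nonzero (suc (suc (suc (suc (suc r))))) s (_ , (s≤s (s≤s (s≤s (s≤s (s≤s ()))))))

  digit5-zero : ∀ n → digit5 0 n ≡ n % 5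
  digit5-zero n = cong (_% 5) (ℕM.n/1≡n n)

  digit5-suc : ∀ i n → digit5 (suc i) n ≡ digit5 i (n / 5)
  digit5-suc i n = cong (_% 5) (sym (ℕM.m/n/o≡m/[n*o] n 5 (5 ^ i) {{_}} {{ℕP.m^n≢0 5 i}} {{ℕP.m^n≢0 5 (suc i)}}))

  digit5-of-0 : ∀ i → digit5 i 0 ≡ 0
  digit5-of-0 i = cong (_% 5) (ℕM.0/n≡0 (5 ^ i) {{ℕP.m^n≢0 5 i}})

  DigitsDominated : ℕ → ℕ → Set
  DigitsDominated m k = ∀ i → digit5 i m ≤ digit5 i k

  dominated-split : ∀ m k → DigitsDominated m k ⇔ (m % 5 ≤ k % 5 × DigitsDominated (m / 5) (k / 5))
  dominated-split m k = mk⇔ (λ h → subst₂ _≤_ (digit5-zero m) (digit5-zero k) (h 0) ,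
                               (λ i → subst₂ _≤_ (digit5-suc i m) (digit5-suc i k) (h (suc i))))
                           λ { (last , rest) zero → subst₂ _≤_ (sym (digit5-zero m)) (sym (digit5-zero k)) last
                          ; (last , rest) (suc i) → subst₂ _≤_ (sym (digit5-suc i m)) (sym (digit5-suc i k)) (rest i) }

  -- 5 ∤ C(k,m) iff the base-5 digits of m are dominated by those of k, by
  -- strong induction on m, peeling off the last digit with Lucas' theorem.
  lucas-digits : ∀ m k → (¬ 5 ∣ binom k m) ⇔ DigitsDominated m k
  lucas-digits = <-rec (λ m → ∀ k → (¬ 5 ∣ binom k m) ⇔ DigitsDominated m k) step
    where
    step : ∀ m → (∀ {c} → c < m → ∀ k → (¬ 5 ∣ binom k c) ⇔ DigitsDominated c k) →
           ∀ k → (¬ 5 ∣ binom k m) ⇔ DigitsDominated m k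
    step zero ih k = mk⇔ (λ _ i → subst (_≤ digit5 i k) (sym (digit5-of-0 i)) z≤n) (λ _ → one-not-divisible)
      where
      one-not-divisible : ¬ 5 ∣ 1
      one-not-divisible d = ℕP.<⇒≱ (s≤s (s≤s z≤n)) (ℕD.∣⇒≤ d)
    step (suc m') ih k = mk⇔ forward backward
      where
      m = suc m'
      r<5 = ℕM.m%n<n k 5
      split : + binom k m ≈ₘ + (binom (k / 5) (m / 5) * binom (k % 5) (m % 5))
      split = subst₂ (λ x y → + binom x y ≈ₘ + (binom (k / 5) (m / 5) * binom (k % 5) (m % 5)))
                (sym (ℕM.m≡m%n+[m/n]*n k 5)) (sym (ℕM.m≡m%n+[m/n]*n m 5))
                (lucas (k / 5) (k % 5) r<5 (m / 5) (m % 5) (ℕM.m%n<n m 5))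
      IH = ih (ℕM.m/n<m m 5 (s≤s (s≤s z≤n))) (k / 5)
      from-product : 5 ∣ (binom (k / 5) (m / 5) * binom (k % 5) (m % 5)) → 5 ∣ binom k m
      from-product d = ≈ₘ0⇒∣ _ (≈ₘ-trans split (∣⇒≈ₘ0 _ d))
      to-product : 5 ∣ binom k m → 5 ∣ (binom (k / 5) (m / 5) * binom (k % 5) (m % 5))
      to-product d = ≈ₘ0⇒∣ _ (≈ₘ-trans (≈ₘ-sym split) (∣⇒≈ₘ0 _ d))
      forward : ¬ 5 ∣ binom k m → DigitsDominated m k
      forward nd = from (dominated-split m k) (last-digit , to IH (λ d → nd (from-product (ℕD.∣m⇒∣m*n _ d))))
        where
        last-digit : m % 5 ≤ k % 5
        last-digit with m % 5 ℕP.≤? k % 5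
        ... | yes p = p
        ... | no ¬p = ⊥-elim (nd (from-product (subst (λ t → 5 ∣ binom (k / 5) (m / 5) * t)
                        (sym (binom-above (k % 5) (m % 5) (ℕP.≰⇒> ¬p)))
                        (subst (5 ∣_) (sym (ℕP.*-zeroʳ (binom (k / 5) (m / 5)))) (divides 0 refl)))))
      backward : DigitsDominated m k → ¬ 5 ∣ binom k m
      backward h d with euclidsLemma _ _ prime5 (to-product d)
      ... | inj₁ d₁ = from IH (proj₂ (to (dominated-split m k) h)) d₁
      ... | inj₂ d₂ = digit-binom-nonzero (k % 5) (m % 5) (proj₁ (to (dominated-split m k) h) , r<5) d₂


-- p_n ≡ W_n (mod 5) coefficientwise, by strong induction along the two
-- recurrences; evaluating at b^(k+1+4m) with n = 5k+4 turns divisibility of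
-- the coefficient of p_(5k+4) into divisibility of C(k,m).
module Congruence where

  open import Defs
  open RationalEmbedding
  open ProductSeries using (module B; 1-b)
  open Recurrence using (p-recurrence; recTerm; divisorSum; falling; divisorSum-0)
  open IntegersModulo 5
  open Reduction
  open ModelMod5
  open TopCoefficients using (W[5k+4]; top-coefficient; binom; signℤ)
  open import Data.Nat using (ℕ; zero; suc; _∸_; _≤_; _<_; s≤s; _+_; _*_)
  import Data.Nat.Properties as ℕP
  import Data.Nat.Tactic.RingSolver as ℕSolver
  open import Data.Nat.Divisibility using (_∣_)
  open import Data.Nat.Induction using (<-rec)
  open import Data.Integer as ℤ using (ℤ; +_; -[1+_])
  import Data.Integer.Properties as ℤP
  open import Data.Integer.Tactic.RingSolver using (solve-∀)
  open import Data.Product using (_,_)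
  open import Function.Bundles using (_⇔_; mk⇔)
  open import Relation.Binary.PropositionalEquality

  1-b⇝[1-b] : 1-b ⇝ˢ [1-b]
  1-b⇝[1-b] zero = reduces (+ 1) refl ≈ₘ-refl
  1-b⇝[1-b] (suc zero) = reduces -[1+ 0 ] refl ≈ₘ-refl
  1-b⇝[1-b] (suc (suc e)) = reduces (+ 0) refl ≈ₘ-refl

  -- p_n ≡ W_n (mod 5): both sides satisfy the same recurrence modulo 5.
  p⇝W : ∀ n → coeff (p n) ⇝ˢ coeffₗ (W n)
  p⇝W = <-rec (λ n → coeff (p n) ⇝ˢ coeffₗ (W n)) step
    where
    step : ∀ n → (∀ {m} → m < n → coeff (p m) ⇝ˢ coeffₗ (W m)) → coeff (p n) ⇝ˢ coeffₗ (W n)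
    step zero _ zero = reduces (+ 1) refl ≈ₘ-refl
    step zero _ (suc e) = reduces (+ 0) refl ≈ₘ-refl
    step (suc n') ih = ⇝ˢ-resp (B.≋-sym (p-recurrence n')) (model-recurrence n')
        (⇝ˢ-* 1-b⇝[1-b] (⇝ˢ-finSum (suc n') summand))
      where
      n = suc n'
      summand : ∀ i → i ≤ n → recTerm n i ⇝ˢ reducedTerm n i
      summand zero _ rewrite divisorSum-0 (n + 5) = ⇝ˢ-zero-scale (coeff (p n)) (coeffₗ (W n))
      summand (suc i) _ = ⇝ˢ-scale (+ (divisorSum (n + 5) (suc i) * falling (n ∸ 1) i))
                                    (ih {n ∸ suc i} (s≤s (ℕP.m∸n≤m n' i)))

  coefficient-reduces : ∀ k m → coeff (p (5 * k + 4)) (k + 1 + 4 * m) ⇝ (+ 2 ℤ.* signℤ m ℤ.* + binom k m)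
  coefficient-reduces k m with p⇝W (5 * k + 4) (k + 1 + 4 * m)
  ... | reduces z embeds congruent = reduces z embeds (≈ₘ-trans congruent
          (subst (λ e → W[5k+4] k e ≈ₘ + 2 ℤ.* signℤ m ℤ.* + binom k m) (sym (exponent k m)) (top-coefficient k m)))
    where
    exponent : ∀ k m → k + 1 + 4 * m ≡ suc (m * 4 + k)
    exponent = ℕSolver.solve-∀

  divisible⇔≈ₘ0 : ∀ {x y} → x ⇝ y → DivisibleBy5 x ⇔ (y ≈ₘ + 0)
  divisible⇔≈ₘ0 {x} (reduces z embeds congruent) = mk⇔ forward backward
    where
    forward : DivisibleBy5 x → _
    forward (z' , x≡) = ≈ₘ-trans (≈ₘ-sym congruent)
      (z' , trans (ι-injective (trans (sym embeds) x≡)) (trans (ℤP.*-comm (+ 5) z') (sym (ℤP.+-identityˡ _))))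
    backward : _ → DivisibleBy5 x
    backward y≈0 with ≈ₘ-trans congruent y≈0
    ... | (q , z≡) = q , trans embeds (cong ι (trans z≡ (trans (ℤP.+-identityˡ _) (ℤP.*-comm q (+ 5)))))

  signℤ² : ∀ m → signℤ m ℤ.* signℤ m ≡ + 1
  signℤ² zero = refl
  signℤ² (suc m) = trans (neg² (signℤ m)) (signℤ² m)
    where neg² : ∀ s → ℤ.- s ℤ.* ℤ.- s ≡ s ℤ.* s
          neg² = solve-∀

  -- 2 and ±1 are units modulo 5 (the inverse of 2s is 3s).
  cancel-unit : ∀ s b → s ℤ.* s ≡ + 1 → + 2 ℤ.* s ℤ.* b ≈ₘ + 0 → b ≈ₘ + 0
  cancel-unit s b s²≡1 v = ≈ₘ-trans (ℤ.- b , b≡) (≈ₘ-trans (*-congₘ (≈ₘ-refl {+ 3 ℤ.* s}) v) (≡⇒≈ₘ (ℤP.*-zeroʳ (+ 3 ℤ.* s))))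
    where
    identity : ∀ s b → b ≡ (+ 3 ℤ.* s) ℤ.* (+ 2 ℤ.* s ℤ.* b) ℤ.+ ℤ.- b ℤ.* + 5 ℤ.+ (+ 1 ℤ.- s ℤ.* s) ℤ.* (+ 6 ℤ.* b)
    identity = solve-∀
    b≡ : b ≡ (+ 3 ℤ.* s) ℤ.* (+ 2 ℤ.* s ℤ.* b) ℤ.+ ℤ.- b ℤ.* + 5
    b≡ = trans (identity s b) (trans (cong (λ t → (+ 3 ℤ.* s) ℤ.* (+ 2 ℤ.* s ℤ.* b) ℤ.+ ℤ.- b ℤ.* + 5 ℤ.+ (+ 1 ℤ.- t) ℤ.* (+ 6 ℤ.* b)) s²≡1)
          (ℤP.+-identityʳ _))

  coefficient-divisible⇔ : ∀ k m → DivisibleBy5 (coeff (p (5 * k + 4)) (k + 1 + 4 * m)) ⇔ 5 ∣ binom k m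
  coefficient-divisible⇔ k m = mk⇔
    (λ d → ≈ₘ0⇒∣ (binom k m) (cancel-unit (signℤ m) _ (signℤ² m) (Equivalence.to reduction d)))
    (λ d → Equivalence.from reduction
      (≈ₘ-trans (*-congₘ (≈ₘ-refl {+ 2 ℤ.* signℤ m}) (∣⇒≈ₘ0 (binom k m) d)) (≡⇒≈ₘ (ℤP.*-zeroʳ (+ 2 ℤ.* signℤ m)))))
    where
    open import Function.Bundles using (Equivalence)
    reduction = divisible⇔≈ₘ0 (coefficient-reduces k m)


open import Defs
open import Data.Nat using (ℕ; _+_; _*_; _≤_)
open import Relation.Nullary using (¬_)
open import Function.Bundles using (_⇔_)
open import Function.Construct.Composition using (_⇔-∘_)
open import Function.Related.TypeIsomorphisms using (¬-cong-⇔)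

-- The divisibility criterion for the coefficients of b^(k+1+4m) in
-- p_(5k+4): by Congruence it is divisibility of C(k,m) by 5, which Lucas'
-- theorem expresses through base-5 digits.
corollary3p1 : (k m : ℕ) → m ≤ k →
    (¬ DivisibleBy5 (coeff (p (5 * k + 4)) (k + 1 + 4 * m)))
    ⇔ (∀ (i : ℕ) → digit5 i m ≤ digit5 i k)
corollary3p1 k m _ = Lucas.lucas-digits m k ⇔-∘ ¬-cong-⇔ (Congruence.coefficient-divisible⇔ k m)
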